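{- Let $M$ be a matroid. (1) If $M^*$ is the dual matroid of $M$, then (over $F_2$ for the first system below, and over any field $K$ of characteristic not $2$ for the second) the polynomial system associated to $M$ and the one associated to $M^*$ coincide up to relabeling of variables. (2) If $M'$ is a minor of $M$, then (in the same settings) the polynomial system associated to $M'$ is, up to relabeling of variables, a subsystem of the polynomial system associated to $M$.
   Context: For a matroid $M$ with circuits $\mathcal{C}(M)$ and cocircuits $\mathcal{C}^*(M)$, introduce variables $a_{e,X}$ for $X\in\mathcal{C}(M)$, $e\in X$, and $b_{e,Y}$ for $Y\in\mathcal{C}^*(M)$, $e\in Y$. The $F_2$-system associated to $M$ consists of: $a_{e,X}+b_{e,Y}+a_{f,X}+b_{f,Y}+1=0$ for all $X\in\mathcal{C}(M)$, $Y\in\mathcal{C}^*(M)$ with $X\cap Y=\{e,f\}$; and, for all $X,Y$ with $X\cap Y=\{e,f,g\}$, the equation $1+a_{e,X}+b_{e,Y}+a_{f,X}+b_{f,Y}+a_{g,X}+b_{g,Y}+a_{e,X}a_{f,X}+a_{e,X}a_{g,X}+a_{e,X}b_{f,Y}+a_{e,X}b_{g,Y}+a_{f,X}a_{g,X}+a_{f,X}b_{e,Y}+a_{f,X}b_{g,Y}+a_{g,X}b_{e,Y}+a_{g,X}b_{f,Y}+b_{e,Y}b_{f,Y}+b_{e,Y}b_{g,Y}+b_{f,Y}b_{g,Y}=0$. The system over a field $K$ of characteristic not $2$ associated to $M$ consists of: $a_{e,X}^2-1=0$ for all $X\in\mathcal{C}(M)$, $e\in X$; $b_{e,Y}^2-1=0$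 for all $Y\in\mathcal{C}^*(M)$, $e\in Y$; $a_{e,X}b_{e,Y}+a_{f,X}b_{f,Y}=0$ for all $X,Y$ with $X\cap Y=\{e,f\}$; and $a_{e,X}b_{e,Y}a_{f,X}b_{f,Y}+a_{f,X}b_{f,Y}a_{g,X}b_{g,Y}+a_{g,X}b_{g,Y}a_{e,X}b_{e,Y}+1=0$ for all $X,Y$ with $X\cap Y=\{e,f,g\}$. (In each case $e,f,g$ denote distinct elements.) -}

module Defs where

open import Level using (0ℓ)
open import Data.Nat using (ℕ; zero; suc)
open import Data.Bool using (Bool; true; false; not; _∧_; _∨_; T)
open import Data.Fin using (Fin)
open import Data.Fin.Subset using (Subset; inside; outside; _∈_; _∉_; _⊆_; _∩_; _∪_; _─_; ∁; ⁅_⁆; ⊥)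
open import Data.Fin.Subset.Properties using (_⊆?_; _⊂?_; nonempty?)
open import Data.List using (List; []; _∷_; _++_; map; foldr)
open import Data.Bool.ListAction using (all; any)
open import Data.Vec using (_∷_; []; tabulate; lookup)
open import Data.Vec.Properties using (≡-dec)
import Data.Bool.Properties as BoolP
open import Data.Product using (Σ; ∃; _×_; _,_)
open import Data.Sum using (_⊎_; inj₁; inj₂)
open import Relation.Nullary using (¬_)
open import Relation.Nullary.Decidable using (⌊_⌋)
open import Relation.Binary.PropositionalEquality using (_≡_; _≢_)
open import Algebra.Bundles using (CommutativeRing)
open import Algebra.Morphism.Structures using (module RingMorphisms)
open import Function.Bundles using (_⤖_; _↣_; Bijection; Injection)

allSubsets : ∀ n → List (Subset n)
allSubsets zero    = [] ∷ []
allSubsets (suc n) = map (outside ∷_) (allSubsets n) ++ map (inside ∷_) (allSubsets n)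

module _ {n : ℕ} where

  _⊆ᵇ_ : Subset n → Subset n → Bool
  X ⊆ᵇ Y = ⌊ X ⊆? Y ⌋

  _⊂ᵇ_ : Subset n → Subset n → Bool
  X ⊂ᵇ Y = ⌊ X ⊂? Y ⌋

  _≡ᵇ_ : Subset n → Subset n → Bool
  X ≡ᵇ Y = ⌊ ≡-dec BoolP._≟_ X Y ⌋

  nonemptyᵇ : Subset n → Bool
  nonemptyᵇ X = ⌊ nonempty? X ⌋

  anySub : (Subset n → Bool) → Bool
  anySub P = any P (allSubsets n)

  allSub : (Subset n → Bool) → Bool
  allSub P = all P (allSubsets n)

CircuitFamily : ℕ → Set
CircuitFamily n = Subset n → Bool

record IsMatroid {n : ℕ} (𝒞 : CircuitFamily n) : Set where
  field
    C1 : ¬ T (𝒞 ⊥)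
    C2 : ∀ X Y → T (𝒞 X) → T (𝒞 Y) → X ⊆ Y → X ≡ Y
    C3 : ∀ X Y (e : Fin n) → T (𝒞 X) → T (𝒞 Y) → X ≢ Y → e ∈ X → e ∈ Y →
         ∃ λ Z → T (𝒞 Z) × Z ⊆ ((X ∪ Y) ─ ⁅ e ⁆)

module _ {n : ℕ} (𝒞 : CircuitFamily n) where

  indepᵇ : Subset n → Bool
  indepᵇ S = not (anySub (λ X → 𝒞 X ∧ (X ⊆ᵇ S)))

  basisᵇ : Subset n → Bool
  basisᵇ B = indepᵇ B ∧ allSub (λ S → not (indepᵇ S ∧ (B ⊂ᵇ S)))

  -- independent in the dual M*: contained in the complement of a basis of M
  -- (the bases of M* are the complements of the bases of M)
  coindepᵇ : Subset n → Bool
  coindepᵇ S = anySub (λ B → basisᵇ B ∧ (S ⊆ᵇ ∁ B))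

  -- circuits of the dual matroid M* (= cocircuits of M):
  -- minimal dependent sets of M*
  dual : CircuitFamily n
  dual S = not (coindepᵇ S) ∧ allSub (λ U → not (U ⊂ᵇ S) ∨ coindepᵇ U)

  -- circuits of the contraction M / C (on E with C removed):
  -- minimal nonempty sets of the form X ─ C, X a circuit of M
  contract : Subset n → CircuitFamily n
  contract C Z =
    nonemptyᵇ Z ∧ isDiff Z ∧
    allSub (λ Z′ → not (Z′ ⊂ᵇ Z ∧ nonemptyᵇ Z′ ∧ isDiff Z′))
    where
    isDiff : Subset n → Bool
    isDiff W = anySub (λ X → 𝒞 X ∧ (W ≡ᵇ (X ─ C)))

delete : ∀ {n} → CircuitFamily n → Subset n → CircuitFamily n
delete 𝒞 D Z = 𝒞 Z ∧ (Z ≡ᵇ (Z ─ D))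

-- circuits of the minor M / C \ D (C, D disjoint), living on E ─ (C ∪ D)
minorCircuits : ∀ {n} → CircuitFamily n → Subset n → Subset n → CircuitFamily n
minorCircuits 𝒞 C D = delete (contract 𝒞 C) D

preimage : ∀ {m n} → (Fin m → Fin n) → Subset n → Subset m
preimage ι Z = tabulate (λ i → lookup Z (ι i))

-- M′ (on Fin m) is a minor of M (on Fin n): there are disjoint C, D ⊆ E(M)
-- and a bijection ι from Fin m onto E(M) ─ (C ∪ D) identifying M′ with M / C \ D
IsMinorOf : ∀ {m n} → CircuitFamily m → CircuitFamily n → Set
IsMinorOf {m} {n} 𝒞′ 𝒞 =
  Σ (Subset n) λ C → Σ (Subset n) λ D → Σ (Fin m → Fin n) λ ι →
    (∀ e → e ∈ C → e ∉ D) ×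
    (∀ i j → ι i ≡ ι j → i ≡ j) ×
    (∀ i → ι i ∉ (C ∪ D)) ×
    (∀ e → e ∉ (C ∪ D) → ∃ λ i → ι i ≡ e) ×
    (∀ Z → Z ⊆ ∁ (C ∪ D) → minorCircuits 𝒞 C D Z ≡ 𝒞′ (preimage ι Z))

infixl 6 _⊕_
infixl 7 _⊗_

data Poly (V : Set) : Set where
  var  : V → Poly V
  one  : Poly V
  neg  : Poly V → Poly V
  _⊕_  : Poly V → Poly V → Poly V
  _⊗_  : Poly V → Poly V → Poly V

rename : ∀ {V W : Set} → (V → W) → Poly V → Poly W
rename σ (var v) = var (σ v)
rename σ one     = one
rename σ (neg p) = neg (rename σ p)
rename σ (p ⊕ q) = rename σ p ⊕ rename σ q
rename σ (p ⊗ q) = rename σ p ⊗ rename σ q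

eval : ∀ {V : Set} (A : CommutativeRing 0ℓ 0ℓ) → (V → CommutativeRing.Carrier A) →
       Poly V → CommutativeRing.Carrier A
eval A ρ (var v) = ρ v
eval A ρ one     = CommutativeRing.1# A
eval A ρ (neg p) = CommutativeRing.-_ A (eval A ρ p)
eval A ρ (p ⊕ q) = CommutativeRing._+_ A (eval A ρ p) (eval A ρ q)
eval A ρ (p ⊗ q) = CommutativeRing._*_ A (eval A ρ p) (eval A ρ q)

-- p and q are equal as elements of the polynomial ring K[V]:
-- they agree under every evaluation in every commutative K-algebra
PolyEq : ∀ {V : Set} (K : CommutativeRing 0ℓ 0ℓ) → Poly V → Poly V → Set₁
PolyEq {V} K p q =
  ∀ (A : CommutativeRing 0ℓ 0ℓ) (h : CommutativeRing.Carrier K → CommutativeRing.Carrier A) →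
    RingMorphisms.IsRingHomomorphism (CommutativeRing.rawRing K) (CommutativeRing.rawRing A) h →
    ∀ (ρ : V → CommutativeRing.Carrier A) →
    CommutativeRing._≈_ A (eval A ρ p) (eval A ρ q)

-- a polynomial system: a family of polynomials (the equations are poly i = 0)
record System (V : Set) : Set₁ where
  field
    Idx  : Set
    poly : Idx → Poly V

open System

Coincide : ∀ {V W : Set} → CommutativeRing 0ℓ 0ℓ → System V → System W → Set₁
Coincide {V} {W} K S₁ S₂ =
  Σ (V ⤖ W) λ σ →
    (∀ i → ∃ λ j → PolyEq K (rename (Bijection.to σ) (poly S₁ i)) (poly S₂ j)) ×
    (∀ j → ∃ λ i → PolyEq K (rename (Bijection.to σ) (poly S₁ i)) (poly S₂ j))

Subsystem : ∀ {V W : Set} → CommutativeRing 0ℓ 0ℓ → System V → System W → Set₁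
Subsystem {V} {W} K S₁ S₂ =
  Σ (V ↣ W) λ σ →
    (∀ i → ∃ λ j → PolyEq K (rename (Injection.to σ) (poly S₁ i)) (poly S₂ j))

F₂ : CommutativeRing 0ℓ 0ℓ
F₂ = BoolP.xor-∧-commutativeRing

IsFieldCharNot2 : CommutativeRing 0ℓ 0ℓ → Set
IsFieldCharNot2 K =
  ¬ (1# ≈ 0#) × (∀ x → ¬ (x ≈ 0#) → ∃ λ y → x * y ≈ 1#) × ¬ ((1# + 1#) ≈ 0#)
  where open CommutativeRing K

module _ {n : ℕ} (𝒞 : CircuitFamily n) where

  -- a_{e,X}: X circuit, e ∈ X
  VarA : Set
  VarA = Σ (Subset n) λ X → T (𝒞 X) × Σ (Fin n) λ e → e ∈ X

  -- b_{e,Y}: Y cocircuit (circuit of M*), e ∈ Y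
  VarB : Set
  VarB = Σ (Subset n) λ Y → T (dual 𝒞 Y) × Σ (Fin n) λ e → e ∈ Y

  Var : Set
  Var = VarA ⊎ VarB

  record Two : Set where
    field
      X Y  : Subset n
      cX   : T (𝒞 X)
      cY   : T (dual 𝒞 Y)
      e f  : Fin n
      e≢f  : e ≢ f
      meet : X ∩ Y ≡ ⁅ e ⁆ ∪ ⁅ f ⁆
      eX   : e ∈ X
      fX   : f ∈ X
      eY   : e ∈ Y
      fY   : f ∈ Y

  record Three : Set where
    field
      X Y   : Subset n
      cX    : T (𝒞 X)
      cY    : T (dual 𝒞 Y)
      e f g : Fin n
      e≢f   : e ≢ f
      e≢g   : e ≢ g
      f≢g   : f ≢ g
      meet  : X ∩ Y ≡ ⁅ e ⁆ ∪ ⁅ f ⁆ ∪ ⁅ g ⁆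
      eX    : e ∈ X
      fX    : f ∈ X
      gX    : g ∈ X
      eY    : e ∈ Y
      fY    : f ∈ Y
      gY    : g ∈ Y

  sumP : List (Poly Var) → Poly Var
  sumP = foldr _⊕_ (neg one ⊕ one)

  twoF₂ : Two → Poly Var
  twoF₂ t = ae ⊕ be ⊕ af ⊕ bf ⊕ one
    where
    open Two t
    ae = var (inj₁ (X , cX , e , eX))
    af = var (inj₁ (X , cX , f , fX))
    be = var (inj₂ (Y , cY , e , eY))
    bf = var (inj₂ (Y , cY , f , fY))

  threeF₂ : Three → Poly Var
  threeF₂ t = sumP
    ( one ∷ ae ∷ be ∷ af ∷ bf ∷ ag ∷ bg
    ∷ ae ⊗ af ∷ ae ⊗ ag ∷ ae ⊗ bf ∷ ae ⊗ bg
    ∷ af ⊗ ag ∷ af ⊗ be ∷ af ⊗ bg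
    ∷ ag ⊗ be ∷ ag ⊗ bf
    ∷ be ⊗ bf ∷ be ⊗ bg ∷ bf ⊗ bg ∷ [] )
    where
    open Three t
    ae = var (inj₁ (X , cX , e , eX))
    af = var (inj₁ (X , cX , f , fX))
    ag = var (inj₁ (X , cX , g , gX))
    be = var (inj₂ (Y , cY , e , eY))
    bf = var (inj₂ (Y , cY , f , fY))
    bg = var (inj₂ (Y , cY , g , gY))

  F₂System : System Var
  F₂System = record { Idx = Two ⊎ Three ; poly = go }
    where
    go : Two ⊎ Three → Poly Var
    go (inj₁ t) = twoF₂ t
    go (inj₂ t) = threeF₂ t

  KSystem : System Var
  KSystem = record { Idx = VarA ⊎ VarB ⊎ Two ⊎ Three ; poly = go }
    where
    go : VarA ⊎ VarB ⊎ Two ⊎ Three → Poly Var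
    go (inj₁ v) = var (inj₁ v) ⊗ var (inj₁ v) ⊕ neg one
    go (inj₂ (inj₁ v)) = var (inj₂ v) ⊗ var (inj₂ v) ⊕ neg one
    go (inj₂ (inj₂ (inj₁ t))) = ae ⊗ be ⊕ af ⊗ bf
      where
      open Two t
      ae = var (inj₁ (X , cX , e , eX))
      af = var (inj₁ (X , cX , f , fX))
      be = var (inj₂ (Y , cY , e , eY))
      bf = var (inj₂ (Y , cY , f , fY))
    go (inj₂ (inj₂ (inj₂ t))) =
      ae ⊗ be ⊗ af ⊗ bf ⊕ af ⊗ bf ⊗ ag ⊗ bg ⊕ ag ⊗ bg ⊗ ae ⊗ be ⊕ one
      where
      open Three t
      ae = var (inj₁ (X , cX , e , eX))
      af = var (inj₁ (X , cX , f , fX))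
      ag = var (inj₁ (X , cX , g , gX))
      be = var (inj₂ (Y , cY , e , eY))
      bf = var (inj₂ (Y , cY , f , fY))
      bg = var (inj₂ (Y , cY , g , gY))

module Submission where

-- The cocircuits of M* are the circuits of M (DoubleDual), so
--     a_{e,X} ↦ b_{e,X}, b_{e,Y} ↦ a_{e,Y} sends circuits of M to cocircuits of
--     M* and cocircuits of M to circuits of M*.  Both systems are symmetric in
--     a and b, so each system embeds into the other along mutually inverse
--     relabelings (Swap), and therefore they coincide (coincide).
-- (2) Minors M′ = M / C \ D.  A circuit X′ of M′ is X ─ C for a circuit X of M
--     avoiding D.  Closure in M′ is closure together with C in M; with I a
--     maximal coindependent subset of D this makes Y′ coindependent in M′
--     exactly when Y′ ∪ I is coindependent in M, so a cocircuit Y′ of M′ is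
--     Y ─ D for a cocircuit Y of M avoiding C.  Then X ∩ Y is the image of
--     X′ ∩ Y′, and relabeling the variables of M′ by these lifts maps each of
--     its equations verbatim onto an equation of M.

open import Defs
open import Level using (0ℓ)
open import Algebra.Bundles using (CommutativeRing)
open import Data.Nat using (ℕ; zero; suc; _<_; _≤_; s≤s)
open import Data.Nat.Properties using (<-≤-trans; ≤-refl)
open import Data.Fin using (Fin; _≟_)
open import Data.Fin.Properties using (any?)
open import Data.Fin.Subset using (Subset; inside; outside; ⊤; _∈_; _∉_; _⊆_; _⊂_; _∩_; _∪_; _─_; ∁; ⁅_⁆; ∣_∣; Nonempty) renaming (⊥ to ∅)
open import Data.Fin.Subset.Properties using (_∈?_; _⊆?_; _⊂?_; nonempty?; ⊆-antisym; ∩-comm; ∉⊥; ∈⊤; p⊂q⇒∣p∣<∣q∣; x∈p∪q⁺; x∈p∪q⁻; x∈p∩q⁺; x∈p∩q⁻; x∈⁅x⁆; x∈⁅y⁆⇒x≡y; x∉p⇒x∈∁p; x∈∁p⇒x∉p; x∈p⇒x∉∁p; x∈p∧x∉q⇒x∈p─q)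
open import Data.Vec using (_∷_; []; here; there; tabulate)
open import Data.Vec.Properties using (≡-dec; []=⇒lookup; lookup⇒[]=; lookup∘tabulate)
open import Data.Vec.Properties.WithK using ([]=-irrelevant)
open import Data.List using (List; []; _∷_; map; allFin)
open import Data.List.Membership.Propositional using () renaming (_∈_ to _∈ₗ_)
open import Data.List.Membership.Propositional.Properties using (∈-map⁺; ∈-++⁺ˡ; ∈-++⁺ʳ; ∈-allFin)
open import Data.List.Relation.Unary.Any using (here; there; satisfied)
import Data.List.Relation.Unary.Any as Any
open import Data.List.Relation.Unary.Any.Properties using (any⁺; any⁻)
import Data.List.Relation.Unary.All as All
open import Data.List.Relation.Unary.All.Properties using (all⁺; all⁻)
open import Data.Bool using (Bool; true; false; not; _∧_; _∨_; T)
import Data.Bool.Properties as BoolP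
open import Data.Bool.Properties using (T-irrelevant)
open import Data.Empty using (⊥; ⊥-elim)
open import Data.Maybe using (nothing)
open import Data.Product using (Σ; ∃; _×_; _,_; proj₁; proj₂)
open import Data.Sum using (_⊎_; inj₁; inj₂; [_,_]′)
open import Function using (id; _∘_)
open import Function.Bundles using (Equivalence; mk⤖; mk↣)
open import Relation.Nullary using (¬_; Dec; yes; no)
open import Relation.Nullary.Decidable using (⌊_⌋; toWitness; fromWitness; _×-dec_; ¬?; T?)
open import Relation.Binary.PropositionalEquality using (_≡_; _≢_; refl; sym; trans; cong; cong₂; subst)
open import Tactic.RingSolver using (solve-∀)
open import Tactic.RingSolver.Core.AlmostCommutativeRing using (fromCommutativeRing; AlmostCommutativeRing)

T-not⁺ : ∀ {b} → ¬ T b → T (not b)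
T-not⁺ {false} _ = _
T-not⁺ {true}  h = h _

T-not⁻ : ∀ {b} → T (not b) → ¬ T b
T-not⁻ {false} _ ()

T-∧⁺ : ∀ {a b} → T a → T b → T (a ∧ b)
T-∧⁺ ta tb = Equivalence.from BoolP.T-∧ (ta , tb)

T-∧⁻ : ∀ {a b} → T (a ∧ b) → T a × T b
T-∧⁻ {a} = Equivalence.to (BoolP.T-∧ {a})

T-∨⁻ : ∀ {a b} → T (a ∨ b) → T a ⊎ T b
T-∨⁻ {a} = Equivalence.to (BoolP.T-∨ {a})

T-∨ˡ : ∀ {a b} → T a → T (a ∨ b)
T-∨ˡ ta = Equivalence.from BoolP.T-∨ (inj₁ ta)

T-∨ʳ : ∀ {a b} → T b → T (a ∨ b)
T-∨ʳ {a} tb = Equivalence.from (BoolP.T-∨ {a}) (inj₂ tb)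

T-stable : ∀ {b} → ¬ ¬ T b → T b
T-stable {true}  _ = _
T-stable {false} h = h λ ()

allSubsets-complete : ∀ n (S : Subset n) → S ∈ₗ allSubsets n
allSubsets-complete zero    []            = here refl
allSubsets-complete (suc n) (outside ∷ S) = ∈-++⁺ˡ (∈-map⁺ (outside ∷_) (allSubsets-complete n S))
allSubsets-complete (suc n) (inside ∷ S)  =
  ∈-++⁺ʳ (map (outside ∷_) (allSubsets n)) (∈-map⁺ (inside ∷_) (allSubsets-complete n S))

module _ {n : ℕ} (p : Subset n → Bool) where

  anySub⁺ : ∀ S → T (p S) → T (anySub p)
  anySub⁺ S pS = any⁺ p (Any.map (λ { refl → pS }) (allSubsets-complete n S))

  anySub⁻ : T (anySub p) → ∃ λ S → T (p S)
  anySub⁻ h = satisfied (any⁻ p (allSubsets n) h)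

  allSub⁺ : (∀ S → T (p S)) → T (allSub p)
  allSub⁺ h = all⁻ p {xs = allSubsets n} (All.tabulate λ {S} _ → h S)

  allSub⁻ : T (allSub p) → ∀ S → T (p S)
  allSub⁻ h S = All.lookup (all⁺ p (allSubsets n) h) (allSubsets-complete n S)

module _ {n : ℕ} {X S : Subset n} where

  ⊆ᵇ⇒⊆ : T (X ⊆ᵇ S) → X ⊆ S
  ⊆ᵇ⇒⊆ = toWitness {a? = X ⊆? S}

  ⊆⇒⊆ᵇ : X ⊆ S → T (X ⊆ᵇ S)
  ⊆⇒⊆ᵇ = fromWitness {a? = X ⊆? S}

  ⊂ᵇ⇒⊂ : T (X ⊂ᵇ S) → X ⊂ S
  ⊂ᵇ⇒⊂ = toWitness {a? = X ⊂? S}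

  ⊂⇒⊂ᵇ : X ⊂ S → T (X ⊂ᵇ S)
  ⊂⇒⊂ᵇ = fromWitness {a? = X ⊂? S}

  ≡ᵇ⇒≡ : T (X ≡ᵇ S) → X ≡ S
  ≡ᵇ⇒≡ = toWitness {a? = ≡-dec BoolP._≟_ X S}

  ≡⇒≡ᵇ : X ≡ S → T (X ≡ᵇ S)
  ≡⇒≡ᵇ = fromWitness {a? = ≡-dec BoolP._≟_ X S}

module _ {n : ℕ} {X : Subset n} where

  nonemptyᵇ⇒ : T (nonemptyᵇ X) → Nonempty X
  nonemptyᵇ⇒ = toWitness {a? = nonempty? X}

  ⇒nonemptyᵇ : Nonempty X → T (nonemptyᵇ X)
  ⇒nonemptyᵇ = fromWitness {a? = nonempty? X}

module _ {n : ℕ} {x : Fin n} where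

  ∈∪ˡ : ∀ {p q : Subset n} → x ∈ p → x ∈ p ∪ q
  ∈∪ˡ h = x∈p∪q⁺ (inj₁ h)

  ∈∪ʳ : ∀ {p q : Subset n} → x ∈ q → x ∈ p ∪ q
  ∈∪ʳ h = x∈p∪q⁺ (inj₂ h)

  ∈∪⁻ : ∀ {p q : Subset n} → x ∈ p ∪ q → x ∈ p ⊎ x ∈ q
  ∈∪⁻ {p} {q} = x∈p∪q⁻ p q

  ∈∩⁺ : ∀ {p q : Subset n} → x ∈ p → x ∈ q → x ∈ p ∩ q
  ∈∩⁺ xp xq = x∈p∩q⁺ (xp , xq)

  ∈∩⁻ : ∀ {p q : Subset n} → x ∈ p ∩ q → x ∈ p × x ∈ q
  ∈∩⁻ {p} {q} = x∈p∩q⁻ p q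

  ∈─⁺ : ∀ {p q : Subset n} → x ∈ p → x ∉ q → x ∈ p ─ q
  ∈─⁺ = x∈p∧x∉q⇒x∈p─q

  ∈∁⁺ : ∀ {p : Subset n} → x ∉ p → x ∈ ∁ p
  ∈∁⁺ = x∉p⇒x∈∁p

  ∈∁⁻ : ∀ {p : Subset n} → x ∈ ∁ p → x ∉ p
  ∈∁⁻ = x∈∁p⇒x∉p

  ∈⁅⁆⁻ : ∀ {y : Fin n} → x ∈ ⁅ y ⁆ → x ≡ y
  ∈⁅⁆⁻ {y} = x∈⁅y⁆⇒x≡y y

  ∈-stable : ∀ {p : Subset n} → ¬ ¬ (x ∈ p) → x ∈ p
  ∈-stable {p} h with x ∈? p
  ... | yes xp = xp
  ... | no  xp = ⊥-elim (h xp)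

∈─⁻ : ∀ {n} {x : Fin n} (p q : Subset n) → x ∈ p ─ q → x ∈ p × x ∉ q
∈─⁻ (_ ∷ p) (_ ∷ q) (there h) = there (proj₁ (∈─⁻ p q h)) , λ { (there w) → proj₂ (∈─⁻ p q h) w }
∈─⁻ (inside ∷ _) (outside ∷ _) here = here , λ ()

∈⁅⁆⁺ : ∀ {n} {x y : Fin n} → x ≡ y → x ∈ ⁅ y ⁆
∈⁅⁆⁺ {x = x} refl = x∈⁅x⁆ x

module _ {n : ℕ} where

  ∪-⊆ : ∀ {p q r : Subset n} → p ⊆ r → q ⊆ r → p ∪ q ⊆ r
  ∪-⊆ p⊆r q⊆r h = [ p⊆r , q⊆r ]′ (∈∪⁻ h)

  ⊆-or-witness : ∀ (p q : Subset n) → p ⊆ q ⊎ ∃ λ x → x ∈ p × x ∉ q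
  ⊆-or-witness p q with any? (λ x → (x ∈? p) ×-dec ¬? (x ∈? q))
  ... | yes w  = inj₂ w
  ... | no  nw = inj₁ λ {x} xp → ∈-stable λ x∉q → nw (x , xp , x∉q)

  ⊆─⇒⊆ : ∀ {Z p q : Subset n} → Z ⊆ p ─ q → Z ⊆ p
  ⊆─⇒⊆ {p = p} {q} Z⊆ h = proj₁ (∈─⁻ p q (Z⊆ h))

  ⊆─⁅⁆⇒∉ : ∀ {Z p : Subset n} {x} → Z ⊆ p ─ ⁅ x ⁆ → x ∉ Z
  ⊆─⁅⁆⇒∉ {p = p} {x} Z⊆ xZ = proj₂ (∈─⁻ p ⁅ x ⁆ (Z⊆ xZ)) (x∈⁅x⁆ x)

  smaller : ∀ {A B : Subset n} {x k} → A ⊆ B → x ∈ B → x ∉ A → ∣ B ∣ ≤ k → ∣ A ∣ < k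
  smaller A⊆B xB x∉A ∣B∣≤k = <-≤-trans (p⊂q⇒∣p∣<∣q∣ (A⊆B , _ , xB , x∉A)) ∣B∣≤k

record MinimalIn {n : ℕ} (q : Subset n → Bool) (S : Subset n) : Set where
  field
    set     : Subset n
    ⊆S      : set ⊆ S
    holds   : T (q set)
    minimal : ∀ U → U ⊂ set → ¬ T (q U)

minimalIn : ∀ {n} (q : Subset n → Bool) S → T (q S) → MinimalIn q S
minimalIn {n} q S = go (suc ∣ S ∣) S ≤-refl
  where
  go : ∀ k S → ∣ S ∣ < k → T (q S) → MinimalIn q S
  go (suc k) S (s≤s ∣S∣≤k) qS with T? (anySub (λ U → (U ⊂ᵇ S) ∧ q U))
  ... | no none = record
    { set = S ; ⊆S = λ h → h ; holds = qS
    ; minimal = λ U U⊂S qU → none (anySub⁺ _ U (T-∧⁺ (⊂⇒⊂ᵇ U⊂S) qU)) }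
  ... | yes some = descend (anySub⁻ _ some)
    where
    descend : (∃ λ U → T ((U ⊂ᵇ S) ∧ q U)) → MinimalIn q S
    descend (U , h) with T-∧⁻ {U ⊂ᵇ S} h
    ... | U⊂ᵇS , qU with ⊂ᵇ⇒⊂ U⊂ᵇS
    ...   | U⊆S , x , xS , x∉U = record { set = set ; ⊆S = λ w → U⊆S (⊆S w) ; holds = holds ; minimal = minimal }
      where open MinimalIn (go k U (smaller U⊆S xS x∉U ∣S∣≤k) qU)

record GreedyExtension {n : ℕ} (p : Subset n → Bool) (J U : Subset n) : Set where
  field
    set     : Subset n
    J⊆      : J ⊆ set
    ⊆J∪U    : set ⊆ J ∪ U
    holds   : T (p set)
    maximal : ∀ e → e ∈ U → e ∉ set → ¬ T (p (set ∪ ⁅ e ⁆))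

module _ {n : ℕ} (p : Subset n → Bool)
         (down : ∀ {S S′} → S ⊆ S′ → T (p S′) → T (p S)) (U : Subset n) where

  private
    record Partial (es : List (Fin n)) (J : Subset n) : Set where
      field
        set     : Subset n
        J⊆      : J ⊆ set
        ⊆J∪U    : set ⊆ J ∪ U
        holds   : T (p set)
        maximal : ∀ e → e ∈ₗ es → e ∈ U → e ∉ set → ¬ T (p (set ∪ ⁅ e ⁆))

    try : ∀ es J → T (p J) → Partial es J
    try [] J pJ = record { set = J ; J⊆ = λ h → h ; ⊆J∪U = ∈∪ˡ ; holds = pJ ; maximal = λ _ () }
    try (e ∷ es) J pJ with e ∈? U | T? (p (J ∪ ⁅ e ⁆))
    ... | yes eU | yes pJe = record
      { set = set ; J⊆ = λ h → J⊆ (∈∪ˡ h) ; ⊆J∪U = ⊆J∪U′ ; holds = holds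
      ; maximal = λ { _ (here refl) _ e∉R _ → e∉R (J⊆ (∈∪ʳ (∈⁅⁆⁺ refl))) ; e′ (there m) → maximal e′ m } }
      where
      open Partial (try es (J ∪ ⁅ e ⁆) pJe)
      ⊆J∪U′ : set ⊆ J ∪ U
      ⊆J∪U′ h = [ ∪-⊆ ∈∪ˡ (λ w → ∈∪ʳ (subst (_∈ U) (sym (∈⁅⁆⁻ w)) eU)) , ∈∪ʳ ]′ (∈∪⁻ (⊆J∪U h))
    ... | yes eU | no ¬pJe = record
      { set = set ; J⊆ = J⊆ ; ⊆J∪U = ⊆J∪U ; holds = holds
      ; maximal = λ { _ (here refl) _ _ pRe → ¬pJe (down (∪-⊆ (λ h → ∈∪ˡ (J⊆ h)) ∈∪ʳ) pRe) ; e′ (there m) → maximal e′ m } }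
      where open Partial (try es J pJ)
    ... | no e∉U | _ = record
      { set = set ; J⊆ = J⊆ ; ⊆J∪U = ⊆J∪U ; holds = holds
      ; maximal = λ { _ (here refl) eU → ⊥-elim (e∉U eU) ; e′ (there m) → maximal e′ m } }
      where open Partial (try es J pJ)

  greedyExtension : ∀ J → T (p J) → GreedyExtension p J U
  greedyExtension J pJ = record
    { set = set ; J⊆ = J⊆ ; ⊆J∪U = ⊆J∪U ; holds = holds ; maximal = λ e → maximal e (∈-allFin e) }
    where open Partial (try (allFin n) J pJ)

module CircuitNotions {n : ℕ} (𝒞 : CircuitFamily n) where

  Circuit : Subset n → Set
  Circuit X = T (𝒞 X)

  Dependent : Subset n → Set
  Dependent S = ∃ λ X → Circuit X × X ⊆ S

  Independent : Subset n → Set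
  Independent S = ¬ Dependent S

  dependent-mono : ∀ {S S′} → S ⊆ S′ → Dependent S → Dependent S′
  dependent-mono S⊆S′ (X , cX , X⊆S) = X , cX , λ h → S⊆S′ (X⊆S h)

  independent-anti : ∀ {S S′} → S ⊆ S′ → Independent S′ → Independent S
  independent-anti S⊆S′ iS′ dS = iS′ (dependent-mono S⊆S′ dS)

  indepᵇ⇒Independent : ∀ {S} → T (indepᵇ 𝒞 S) → Independent S
  indepᵇ⇒Independent {S} h (X , cX , X⊆S) = T-not⁻ h (anySub⁺ _ X (T-∧⁺ cX (⊆⇒⊆ᵇ X⊆S)))

  Independent⇒indepᵇ : ∀ {S} → Independent S → T (indepᵇ 𝒞 S)
  Independent⇒indepᵇ {S} iS = T-not⁺ λ h →
    let X , cX∧X⊆S = anySub⁻ _ h ; cX , X⊆S = T-∧⁻ {𝒞 X} cX∧X⊆S in iS (X , cX , ⊆ᵇ⇒⊆ X⊆S)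

  dependent? : ∀ S → Dependent S ⊎ Independent S
  dependent? S with T? (indepᵇ 𝒞 S)
  ... | yes iS = inj₂ (indepᵇ⇒Independent iS)
  ... | no ¬iS = inj₁ (X , cX , ⊆ᵇ⇒⊆ X⊆S)
    where
    found = anySub⁻ _ (T-stable λ h → ¬iS (T-not⁺ h))
    X = proj₁ found
    cX = proj₁ (T-∧⁻ {𝒞 X} (proj₂ found))
    X⊆S = proj₂ (T-∧⁻ {𝒞 X} (proj₂ found))

  ¬independent⇒dependent : ∀ {S} → ¬ Independent S → Dependent S
  ¬independent⇒dependent {S} ¬iS = [ id , (λ i → ⊥-elim (¬iS i)) ]′ (dependent? S)

  record CircuitThrough (e : Fin n) (S : Subset n) : Set where
    constructor circuitThrough
    field
      circuit   : Subset n
      isCircuit : Circuit circuit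
      ∋e        : e ∈ circuit
      ⊆S        : circuit ⊆ S

  infix 4 _∈cl_ _⊆cl_
  _∈cl_ : Fin n → Subset n → Set
  e ∈cl J = e ∈ J ⊎ CircuitThrough e (J ∪ ⁅ e ⁆)

  _⊆cl_ : Subset n → Subset n → Set
  S ⊆cl J = ∀ e → e ∈ S → e ∈cl J

  Spanning : Subset n → Set
  Spanning J = ∀ e → e ∈cl J

  cl-mono : ∀ {J J′ e} → J ⊆ J′ → e ∈cl J → e ∈cl J′
  cl-mono J⊆J′ (inj₁ eJ) = inj₁ (J⊆J′ eJ)
  cl-mono J⊆J′ (inj₂ (circuitThrough X cX eX X⊆)) = inj₂ (circuitThrough X cX eX λ h → [ (λ w → ∈∪ˡ (J⊆J′ w)) , ∈∪ʳ ]′ (∈∪⁻ (X⊆ h)))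

  -- adding e to an independent J creates a dependency only through e
  dependent⇒∈cl : ∀ {J e} → Independent J → Dependent (J ∪ ⁅ e ⁆) → e ∈cl J
  dependent⇒∈cl {J} {e} iJ (X , cX , X⊆) with e ∈? X
  ... | yes eX = inj₂ (circuitThrough X cX eX X⊆)
  ... | no e∉X = ⊥-elim (iJ (X , cX , λ {z} zX →
          [ id , (λ z≡e → ⊥-elim (e∉X (subst (_∈ X) (∈⁅⁆⁻ z≡e) zX))) ]′ (∈∪⁻ (X⊆ zX))))

  Basis : Subset n → Set
  Basis B = Independent B × (∀ e → e ∉ B → Dependent (B ∪ ⁅ e ⁆))

  basis⇒spanning : ∀ {B} → Basis B → Spanning B
  basis⇒spanning {B} (iB , maxB) e with e ∈? B
  ... | yes eB = inj₁ eB
  ... | no e∉B = dependent⇒∈cl iB (maxB e e∉B)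

  independent-spanning⇒basis : ∀ {B} → Independent B → Spanning B → Basis B
  independent-spanning⇒basis {B} iB spB = iB , λ e e∉B → dependency e e∉B (spB e)
    where
    dependency : ∀ e → e ∉ B → e ∈cl B → Dependent (B ∪ ⁅ e ⁆)
    dependency e e∉B (inj₁ eB) = ⊥-elim (e∉B eB)
    dependency e e∉B (inj₂ (circuitThrough X cX _ X⊆)) = X , cX , X⊆

  basisᵇ⇒Basis : ∀ {B} → T (basisᵇ 𝒞 B) → Basis B
  basisᵇ⇒Basis {B} h = indepᵇ⇒Independent iB , λ e e∉B →
    ¬independent⇒dependent λ iBe → T-not⁻ (noLarger (B ∪ ⁅ e ⁆))
      (T-∧⁺ (Independent⇒indepᵇ iBe) (⊂⇒⊂ᵇ (∈∪ˡ , e , ∈∪ʳ (x∈⁅x⁆ e) , e∉B)))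
    where
    iB = proj₁ (T-∧⁻ {indepᵇ 𝒞 B} h)
    noLarger = allSub⁻ _ (proj₂ (T-∧⁻ {indepᵇ 𝒞 B} h))

  Basis⇒basisᵇ : ∀ {B} → Basis B → T (basisᵇ 𝒞 B)
  Basis⇒basisᵇ {B} (iB , maxB) = T-∧⁺ (Independent⇒indepᵇ iB) (allSub⁺ _ λ S → T-not⁺ λ h →
    let iS , B⊂S = T-∧⁻ {indepᵇ 𝒞 S} h ; B⊆S , x , xS , x∉B = ⊂ᵇ⇒⊂ B⊂S
    in indepᵇ⇒Independent iS (dependent-mono (∪-⊆ B⊆S (λ w → subst (_∈ S) (sym (∈⁅⁆⁻ w)) xS)) (maxB x x∉B)))

  Coindependent : Subset n → Set
  Coindependent S = ∃ λ B → Basis B × S ⊆ ∁ B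

  coindependent-anti : ∀ {S S′} → S ⊆ S′ → Coindependent S′ → Coindependent S
  coindependent-anti S⊆S′ (B , bB , S′⊆) = B , bB , λ h → S′⊆ (S⊆S′ h)

  coindepᵇ⇒Coindependent : ∀ {S} → T (coindepᵇ 𝒞 S) → Coindependent S
  coindepᵇ⇒Coindependent {S} h =
    let B , t = anySub⁻ _ h ; bB , S⊆ = T-∧⁻ {basisᵇ 𝒞 B} t in B , basisᵇ⇒Basis bB , ⊆ᵇ⇒⊆ S⊆

  Coindependent⇒coindepᵇ : ∀ {S} → Coindependent S → T (coindepᵇ 𝒞 S)
  Coindependent⇒coindepᵇ (B , bB , S⊆) = anySub⁺ _ B (T-∧⁺ (Basis⇒basisᵇ bB) (⊆⇒⊆ᵇ S⊆))

  coindependent-stable : ∀ {S} → ¬ ¬ Coindependent S → Coindependent S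
  coindependent-stable ¬¬cS = coindepᵇ⇒Coindependent (T-stable λ ¬c → ¬¬cS λ cS → ¬c (Coindependent⇒coindepᵇ cS))

  Cocircuit : Subset n → Set
  Cocircuit Y = ¬ Coindependent Y × (∀ U → U ⊂ Y → Coindependent U)

  dual⇒Cocircuit : ∀ {Y} → T (dual 𝒞 Y) → Cocircuit Y
  dual⇒Cocircuit {Y} h = (λ cY → T-not⁻ ¬cY (Coindependent⇒coindepᵇ cY)) , λ U U⊂Y →
    [ (λ ¬U⊂Y → ⊥-elim (T-not⁻ ¬U⊂Y (⊂⇒⊂ᵇ U⊂Y))) , coindepᵇ⇒Coindependent ]′ (T-∨⁻ {not (U ⊂ᵇ Y)} (minY U))
    where
    ¬cY = proj₁ (T-∧⁻ {not (coindepᵇ 𝒞 Y)} h)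
    minY = allSub⁻ _ (proj₂ (T-∧⁻ {not (coindepᵇ 𝒞 Y)} h))

  Cocircuit⇒dual : ∀ {Y} → Cocircuit Y → T (dual 𝒞 Y)
  Cocircuit⇒dual {Y} (¬cY , minY) = T-∧⁺ (T-not⁺ λ h → ¬cY (coindepᵇ⇒Coindependent h)) (allSub⁺ _ λ U →
    T-∨-proper U (T? (U ⊂ᵇ Y)))
    where
    T-∨-proper : ∀ U → Dec (T (U ⊂ᵇ Y)) → T (not (U ⊂ᵇ Y) ∨ coindepᵇ 𝒞 U)
    T-∨-proper U (yes U⊂Y) = T-∨ʳ {not (U ⊂ᵇ Y)} (Coindependent⇒coindepᵇ (minY U (⊂ᵇ⇒⊂ U⊂Y)))
    T-∨-proper U (no ¬U⊂Y) = T-∨ˡ (T-not⁺ ¬U⊂Y)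

  cocircuit-within : ∀ S → ¬ Coindependent S → ∃ λ Y → Y ⊆ S × Cocircuit Y
  cocircuit-within S ¬cS = set , ⊆S , (λ cY → T-not⁻ holds (Coindependent⇒coindepᵇ cY)) ,
                           λ U U⊂Y → coindepᵇ⇒Coindependent (T-stable λ ¬cU → minimal U U⊂Y (T-not⁺ ¬cU))
    where open MinimalIn (minimalIn (λ U → not (coindepᵇ 𝒞 U)) S (T-not⁺ λ h → ¬cS (coindepᵇ⇒Coindependent h)))

module MatroidTheory {n : ℕ} {𝒞 : CircuitFamily n} (M : IsMatroid 𝒞) where
  open CircuitNotions 𝒞 public
  open IsMatroid M

  independent-∅ : Independent ∅
  independent-∅ (X , cX , X⊆∅) = C1 (subst (λ Z → T (𝒞 Z)) (⊆-antisym X⊆∅ (λ h → ⊥-elim (∉⊥ h))) cX)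

  strong-elimination : ∀ X₁ X₂ {e f} → Circuit X₁ → Circuit X₂ → e ∈ X₁ → e ∈ X₂ → f ∈ X₁ → f ∉ X₂ →
                       CircuitThrough f ((X₁ ∪ X₂) ─ ⁅ e ⁆)
  strong-elimination X₁ X₂ = go (suc ∣ X₁ ∪ X₂ ∣) X₁ X₂ ≤-refl
    where
    go : ∀ k X₁ X₂ {e f} → ∣ X₁ ∪ X₂ ∣ < k → Circuit X₁ → Circuit X₂ → e ∈ X₁ → e ∈ X₂ → f ∈ X₁ → f ∉ X₂ →
         CircuitThrough f ((X₁ ∪ X₂) ─ ⁅ e ⁆)
    go (suc k) X₁ X₂ {e} {f} (s≤s size) c₁ c₂ eX₁ eX₂ fX₁ f∉X₂
      with C3 X₁ X₂ e c₁ c₂ (λ X₁≡X₂ → f∉X₂ (subst (f ∈_) X₁≡X₂ fX₁)) eX₁ eX₂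
    ... | Z₃ , c₃ , Z₃⊆ with f ∈? Z₃ | ⊆-or-witness Z₃ X₁
    ...   | yes fZ₃ | _ = circuitThrough Z₃ c₃ fZ₃ Z₃⊆
    -- Z₃ ⊆ X₁ would force Z₃ = X₁ ∋ e
    ...   | no _ | inj₁ Z₃⊆X₁ = ⊥-elim (⊆─⁅⁆⇒∉ Z₃⊆ (subst (e ∈_) (sym (C2 Z₃ X₁ c₃ c₁ Z₃⊆X₁)) eX₁))
    -- otherwise some g ∈ Z₃ lies in X₂ ─ X₁, and two smaller eliminations repair Z₃
    ...   | no f∉Z₃ | inj₂ (g , gZ₃ , g∉X₁) =
      circuitThrough Z₅ c₅ fZ₅ λ h → let z∈ , z≢e = ∈─⁻ (X₁ ∪ Z₄) ⁅ e ⁆ (Z₅⊆ h) in ∈─⁺ (∪-⊆ ∈∪ˡ Z₄⊆X₁∪X₂ z∈) z≢e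
      where
      gX₂ : g ∈ X₂
      gX₂ = [ (λ gX₁ → ⊥-elim (g∉X₁ gX₁)) , id ]′ (∈∪⁻ (⊆─⇒⊆ Z₃⊆ gZ₃))
      -- eliminate g between X₂ and Z₃ keeping e; f lies outside both
      open CircuitThrough (go k X₂ Z₃ (smaller (∪-⊆ ∈∪ʳ (⊆─⇒⊆ Z₃⊆)) (∈∪ˡ fX₁) (λ w → [ f∉X₂ , f∉Z₃ ]′ (∈∪⁻ w)) size)
                              c₂ c₃ gX₂ gZ₃ eX₂ (⊆─⁅⁆⇒∉ Z₃⊆))
        renaming (circuit to Z₄; isCircuit to c₄; ∋e to eZ₄; ⊆S to Z₄⊆)
      Z₄⊆X₁∪X₂ : Z₄ ⊆ X₁ ∪ X₂
      Z₄⊆X₁∪X₂ h = ∪-⊆ ∈∪ʳ (⊆─⇒⊆ Z₃⊆) (⊆─⇒⊆ Z₄⊆ h)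
      f∉Z₄ : f ∉ Z₄
      f∉Z₄ w = [ f∉X₂ , f∉Z₃ ]′ (∈∪⁻ (⊆─⇒⊆ Z₄⊆ w))
      -- eliminate e between X₁ and Z₄ keeping f; g lies outside both
      open CircuitThrough (go k X₁ Z₄ (smaller (∪-⊆ ∈∪ˡ Z₄⊆X₁∪X₂) (∈∪ʳ gX₂) (λ w → [ g∉X₁ , ⊆─⁅⁆⇒∉ Z₄⊆ ]′ (∈∪⁻ w)) size)
                              c₁ c₄ eX₁ eZ₄ fX₁ f∉Z₄)
        renaming (circuit to Z₅; isCircuit to c₅; ∋e to fZ₅; ⊆S to Z₅⊆)

  -- If every element of the circuit X outside J ∪ {f} has a circuit through it
  -- inside J ∪ {b}, these can be eliminated one by one from X, leaving a
  -- circuit through f inside J ∪ {f}.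
  circuit-into-closure : ∀ J f X → Circuit X → f ∈ X → f ∉ J →
                         (∀ b → b ∈ X → b ∉ J → b ≢ f → CircuitThrough b (J ∪ ⁅ b ⁆)) →
                         CircuitThrough f (J ∪ ⁅ f ⁆)
  circuit-into-closure J f X = go (suc ∣ X ─ (J ∪ ⁅ f ⁆) ∣) X ≤-refl
    where
    go : ∀ k X → ∣ X ─ (J ∪ ⁅ f ⁆) ∣ < k → Circuit X → f ∈ X → f ∉ J →
         (∀ b → b ∈ X → b ∉ J → b ≢ f → CircuitThrough b (J ∪ ⁅ b ⁆)) →
         CircuitThrough f (J ∪ ⁅ f ⁆)
    go (suc k) X (s≤s size) cX fX f∉J elsewhere with ⊆-or-witness X (J ∪ ⁅ f ⁆)
    ... | inj₁ X⊆ = circuitThrough X cX fX X⊆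
    ... | inj₂ (b , bX , b∉J∪f) = go k Z fewer cZ fZ f∉J λ b′ b′Z b′∉J → elsewhere b′ (Z∖J⊆X b′Z b′∉J) b′∉J
      where
      b∉J : b ∉ J
      b∉J bJ = b∉J∪f (∈∪ˡ bJ)
      b≢f : b ≢ f
      b≢f b≡f = b∉J∪f (∈∪ʳ (∈⁅⁆⁺ b≡f))
      open CircuitThrough (elsewhere b bX b∉J b≢f) renaming (circuit to Xb; isCircuit to cb; ∋e to bXb; ⊆S to Xb⊆)
      f∉Xb : f ∉ Xb
      f∉Xb fXb = [ f∉J , (λ f≡b → b≢f (sym (∈⁅⁆⁻ f≡b))) ]′ (∈∪⁻ (Xb⊆ fXb))
      open CircuitThrough (strong-elimination X Xb cX cb bX bXb fX f∉Xb)
        renaming (circuit to Z; isCircuit to cZ; ∋e to fZ; ⊆S to Z⊆)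
      -- Z has lost b, and gained nothing outside J
      Z∖J⊆X : ∀ {z} → z ∈ Z → z ∉ J → z ∈ X
      Z∖J⊆X {z} zZ z∉J with ∈─⁻ (X ∪ Xb) ⁅ b ⁆ (Z⊆ zZ)
      ... | z∈X∪Xb , z≢b = [ id , (λ zXb → [ (λ zJ → ⊥-elim (z∉J zJ)) , (λ z≡b → ⊥-elim (z≢b z≡b)) ]′ (∈∪⁻ (Xb⊆ zXb))) ]′
                             (∈∪⁻ z∈X∪Xb)
      fewer : ∣ Z ─ (J ∪ ⁅ f ⁆) ∣ < k
      fewer = smaller (λ h → let zZ , z∉ = ∈─⁻ Z (J ∪ ⁅ f ⁆) h in ∈─⁺ (Z∖J⊆X zZ (λ zJ → z∉ (∈∪ˡ zJ))) z∉)
                      (∈─⁺ bX b∉J∪f) (λ h → ⊆─⁅⁆⇒∉ Z⊆ (proj₁ (∈─⁻ Z (J ∪ ⁅ f ⁆) h))) size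

  cl-trans : ∀ {S J e} → e ∈cl S → S ⊆cl J → e ∈cl J
  cl-trans (inj₁ eS) S⊆clJ = S⊆clJ _ eS
  cl-trans {S} {J} {e} (inj₂ (circuitThrough X cX eX X⊆)) S⊆clJ with e ∈? J
  ... | yes eJ = inj₁ eJ
  ... | no e∉J = inj₂ (circuit-into-closure J e X cX eX e∉J through)
    where
    through : ∀ b → b ∈ X → b ∉ J → b ≢ e → CircuitThrough b (J ∪ ⁅ b ⁆)
    through b bX b∉J b≢e with ∈∪⁻ (X⊆ bX)
    ... | inj₂ b≡e = ⊥-elim (b≢e (∈⁅⁆⁻ b≡e))
    ... | inj₁ bS with S⊆clJ b bS
    ...   | inj₁ bJ = ⊥-elim (b∉J bJ)
    ...   | inj₂ c = c

  spanning-trans : ∀ {S J} → Spanning S → S ⊆cl J → Spanning J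
  spanning-trans spS S⊆clJ e = cl-trans (spS e) S⊆clJ

  record IndependentExtension (J U : Subset n) : Set where
    field
      set         : Subset n
      J⊆          : J ⊆ set
      ⊆J∪U        : set ⊆ J ∪ U
      independent : Independent set
      spans       : U ⊆cl set

  extend : ∀ U J → Independent J → IndependentExtension J U
  extend U J iJ = record { set = set ; J⊆ = J⊆ ; ⊆J∪U = ⊆J∪U ; independent = indepᵇ⇒Independent holds ; spans = spans }
    where
    open GreedyExtension (greedyExtension (indepᵇ 𝒞)
      (λ S⊆S′ h → Independent⇒indepᵇ (independent-anti S⊆S′ (indepᵇ⇒Independent h))) U J (Independent⇒indepᵇ iJ))
    spans : U ⊆cl set
    spans e eU with e ∈? set
    ... | yes eR = inj₁ eR
    ... | no e∉R = dependent⇒∈cl (indepᵇ⇒Independent holds)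
                     (¬independent⇒dependent λ i → maximal e eU e∉R (Independent⇒indepᵇ i))

  basis-extension : ∀ S → Independent S → ∃ λ B → Basis B × S ⊆ B
  basis-extension S iS = set , independent-spanning⇒basis independent (λ e → spans e ∈⊤) , J⊆
    where open IndependentExtension (extend ⊤ S iS)

  coindependent-∅ : Coindependent ∅
  coindependent-∅ with basis-extension ∅ independent-∅
  ... | B , bB , _ = B , bB , λ h → ⊥-elim (∉⊥ h)

  coindependent⇒spanning∁ : ∀ {S} → Coindependent S → Spanning (∁ S)
  coindependent⇒spanning∁ (B , bB , S⊆∁B) e =
    cl-mono (λ zB → ∈∁⁺ λ zS → ∈∁⁻ (S⊆∁B zS) zB) (basis⇒spanning bB e)

  spanning∁⇒coindependent : ∀ {S} → Spanning (∁ S) → Coindependent S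
  spanning∁⇒coindependent {S} sp = set , independent-spanning⇒basis independent (spanning-trans sp spans) ,
    λ zS → ∈∁⁺ λ zR → [ (λ z∅ → ∉⊥ z∅) , (λ z∁S → ∈∁⁻ z∁S zS) ]′ (∈∪⁻ (⊆J∪U zR))
    where open IndependentExtension (extend (∁ S) ∅ independent-∅)

  record MaximalCoindependent (D : Subset n) : Set where
    field
      set           : Subset n
      ⊆D            : set ⊆ D
      coindependent : Coindependent set
      maximal       : ∀ d → d ∈ D → d ∉ set → ¬ Coindependent (set ∪ ⁅ d ⁆)

  maximal-coindependent : ∀ D → MaximalCoindependent D
  maximal-coindependent D = record
    { set = set ; ⊆D = λ h → [ (λ h∅ → ⊥-elim (∉⊥ h∅)) , id ]′ (∈∪⁻ (⊆J∪U h))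
    ; coindependent = coindepᵇ⇒Coindependent holds
    ; maximal = λ d dD d∉ cI → maximal d dD d∉ (Coindependent⇒coindepᵇ cI) }
    where
    open GreedyExtension (greedyExtension (coindepᵇ 𝒞)
      (λ S⊆S′ h → Coindependent⇒coindepᵇ (coindependent-anti S⊆S′ (coindepᵇ⇒Coindependent h)))
      D ∅ (Coindependent⇒coindepᵇ coindependent-∅))

  -- If I is maximal coindependent in D, every d ∈ D ─ I is a coloop of the
  -- restriction to ∁ I; hence D ─ I never helps to span elements outside D.
  cl-without-coloops : ∀ {D} (I : MaximalCoindependent D) {S e} → S ⊆ ∁ D → e ∉ D →
                       e ∈cl (S ∪ (D ─ MaximalCoindependent.set I)) → e ∈cl S
  cl-without-coloops {D} I {S} {e} S⊆∁D e∉D (inj₁ eS∪) =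
    [ inj₁ , (λ eD∖I → ⊥-elim (e∉D (proj₁ (∈─⁻ D _ eD∖I)))) ]′ (∈∪⁻ eS∪)
  cl-without-coloops {D} I {S} {e} S⊆∁D e∉D (inj₂ (circuitThrough X cX eX X⊆)) with ⊆-or-witness X (S ∪ ⁅ e ⁆)
  ... | inj₁ X⊆S∪e = inj₂ (circuitThrough X cX eX X⊆S∪e)
  ... | inj₂ (q , qX , q∉S∪e) = ⊥-elim (maximal q (proj₁ q∈D∖I) (proj₂ q∈D∖I) (spanning∁⇒coindependent spans))
    where
    open MaximalCoindependent I
    q∈D∖I : q ∈ D × q ∉ set
    q∈D∖I = ∈─⁻ D set ([ [ (λ qS → ⊥-elim (q∉S∪e (∈∪ˡ qS))) , id ]′ ∘ ∈∪⁻ , (λ q≡e → ⊥-elim (q∉S∪e (∈∪ʳ q≡e))) ]′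
                         (∈∪⁻ (X⊆ qX)))
    X∩I=∅ : ∀ {x} → x ∈ X → x ∉ set
    X∩I=∅ xX xI = [ [ (λ xS → ∈∁⁻ (S⊆∁D xS) (⊆D xI)) , (λ xD∖I → proj₂ (∈─⁻ D set xD∖I) xI) ]′ ∘ ∈∪⁻ ,
                    (λ x≡e → e∉D (subst (_∈ D) (∈⁅⁆⁻ x≡e) (⊆D xI))) ]′ (∈∪⁻ (X⊆ xX))
    -- X avoids I, so q ∈ cl (∁ (I ∪ {q}))
    q∈cl : q ∈cl ∁ (set ∪ ⁅ q ⁆)
    q∈cl = inj₂ (circuitThrough X cX qX X⊆∁I∪q∪q)
      where
      X⊆∁I∪q∪q : X ⊆ ∁ (set ∪ ⁅ q ⁆) ∪ ⁅ q ⁆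
      X⊆∁I∪q∪q {x} xX with x ≟ q
      ... | yes x≡q = ∈∪ʳ (∈⁅⁆⁺ x≡q)
      ... | no x≢q = ∈∪ˡ (∈∁⁺ λ x∈ → [ X∩I=∅ xX , (λ x≡q → x≢q (∈⁅⁆⁻ x≡q)) ]′ (∈∪⁻ x∈))
    -- so ∁ (I ∪ {q}) spans ∁ I, which spans everything as I is coindependent
    spans : Spanning (∁ (set ∪ ⁅ q ⁆))
    spans = spanning-trans (coindependent⇒spanning∁ coindependent) λ z z∈∁I → case-q z (∈∁⁻ z∈∁I)
      where
      case-q : ∀ z → z ∉ set → z ∈cl ∁ (set ∪ ⁅ q ⁆)
      case-q z z∉I with z ≟ q
      ... | yes refl = q∈cl
      ... | no z≢q = inj₁ (∈∁⁺ λ z∈ → [ z∉I , (λ z≡q → z≢q (∈⁅⁆⁻ z≡q)) ]′ (∈∪⁻ z∈))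

  circuit⇒minimal : ∀ {X} → Circuit X → ∀ U → U ⊂ X → Independent U
  circuit⇒minimal {X} cX U (U⊆X , x , xX , x∉U) (X′ , cX′ , X′⊆U) =
    x∉U (X′⊆U (subst (x ∈_) (sym (C2 X′ X cX′ cX (λ h → U⊆X (X′⊆U h)))) xX))

  minimal-dependent⇒circuit : ∀ {X} → Dependent X → (∀ U → U ⊂ X → Independent U) → Circuit X
  minimal-dependent⇒circuit {X} (X′ , cX′ , X′⊆X) minX with ⊆-or-witness X X′
  ... | inj₁ X⊆X′ = subst Circuit (⊆-antisym X′⊆X X⊆X′) cX′
  ... | inj₂ (y , yX , y∉X′) = ⊥-elim (minX X′ (X′⊆X , y , yX , y∉X′) (X′ , cX′ , λ h → h))

module DoubleDual {n : ℕ} {𝒞 : CircuitFamily n} (M : IsMatroid 𝒞) where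
  open MatroidTheory M
  module * = CircuitNotions (dual 𝒞)

  independent*⇒coindependent : ∀ {S} → *.Independent S → Coindependent S
  independent*⇒coindependent {S} iS = coindependent-stable λ ¬cS →
    let Y , Y⊆S , coY = cocircuit-within S ¬cS in iS (Y , Cocircuit⇒dual coY , Y⊆S)

  coindependent⇒independent* : ∀ {S} → Coindependent S → *.Independent S
  coindependent⇒independent* cS (Y , cY , Y⊆S) = proj₁ (dual⇒Cocircuit cY) (coindependent-anti Y⊆S cS)

  basis*⇒basis∁ : ∀ {B} → *.Basis B → Basis (∁ B)
  basis*⇒basis∁ {B} (iB , maxB) = complement-is-basis (independent*⇒coindependent iB)
    where
    -- B avoids some basis B₀; by maximality of B in the dual, B₀ = ∁ B
    complement-is-basis : Coindependent B → Basis (∁ B)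
    complement-is-basis (B₀ , bB₀ , B⊆∁B₀) = subst Basis (⊆-antisym B₀⊆∁B ∁B⊆B₀) bB₀
      where
      B₀⊆∁B : B₀ ⊆ ∁ B
      B₀⊆∁B zB₀ = ∈∁⁺ λ zB → ∈∁⁻ (B⊆∁B₀ zB) zB₀
      ∁B⊆B₀ : ∁ B ⊆ B₀
      ∁B⊆B₀ {e} e∈∁B = ∈-stable λ e∉B₀ →
        coindependent⇒independent* (B₀ , bB₀ , ∪-⊆ B⊆∁B₀ (λ w → subst (_∈ ∁ B₀) (sym (∈⁅⁆⁻ w)) (∈∁⁺ e∉B₀)))
          (maxB e (∈∁⁻ e∈∁B))

  basis⇒basis*∁ : ∀ {B} → Basis B → *.Basis (∁ B)
  basis⇒basis*∁ {B} bB = coindependent⇒independent* (B , bB , λ h → h) , λ e e∉∁B →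
    *.¬independent⇒dependent λ i → let B₁ , bB₁ , ∁B∪e⊆∁B₁ = independent*⇒coindependent i in
      proj₁ bB (dependent-mono
        (∪-⊆ (λ zB₁ → ∈-stable λ z∉B → ∈∁⁻ (∁B∪e⊆∁B₁ (∈∪ˡ (∈∁⁺ z∉B))) zB₁)
             (λ w → subst (_∈ B) (sym (∈⁅⁆⁻ w)) (∈-stable λ e∉B → e∉∁B (∈∁⁺ e∉B))))
        (proj₂ bB₁ e λ eB₁ → ∈∁⁻ (∁B∪e⊆∁B₁ (∈∪ʳ (x∈⁅x⁆ e))) eB₁))

  coindependent*⇒independent : ∀ {S} → *.Coindependent S → Independent S
  coindependent*⇒independent (B , bB , S⊆∁B) = independent-anti S⊆∁B (proj₁ (basis*⇒basis∁ bB))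

  independent⇒coindependent* : ∀ {S} → Independent S → *.Coindependent S
  independent⇒coindependent* {S} iS =
    let B , bB , S⊆B = basis-extension S iS in ∁ B , basis⇒basis*∁ bB , λ zS → ∈∁⁺ (x∈p⇒x∉∁p (S⊆B zS))

  circuit⇒dual-dual : ∀ {X} → T (𝒞 X) → T (dual (dual 𝒞) X)
  circuit⇒dual-dual {X} cX = *.Cocircuit⇒dual
    ( (λ c* → coindependent*⇒independent c* (X , cX , λ h → h))
    , λ U U⊂X → independent⇒coindependent* (circuit⇒minimal cX U U⊂X) )

  dual-dual⇒circuit : ∀ {X} → T (dual (dual 𝒞) X) → T (𝒞 X)
  dual-dual⇒circuit {X} h =
    let ¬c* , min* = *.dual⇒Cocircuit h in minimal-dependent⇒circuit
    (¬independent⇒dependent λ iX → ¬c* (independent⇒coindependent* iX))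
    (λ U U⊂X → coindependent*⇒independent (min* U U⊂X))

module _ {V W : Set} where

  rename-inverse : (σ : V → W) (τ : W → V) → (∀ w → σ (τ w) ≡ w) → ∀ p → rename σ (rename τ p) ≡ p
  rename-inverse σ τ στ (var w) = cong var (στ w)
  rename-inverse σ τ στ one     = refl
  rename-inverse σ τ στ (neg p) = cong neg (rename-inverse σ τ στ p)
  rename-inverse σ τ στ (p ⊕ q) = cong₂ _⊕_ (rename-inverse σ τ στ p) (rename-inverse σ τ στ q)
  rename-inverse σ τ στ (p ⊗ q) = cong₂ _⊗_ (rename-inverse σ τ στ p) (rename-inverse σ τ στ q)

  eval-rename : ∀ (A : CommutativeRing 0ℓ 0ℓ) ρ (σ : V → W) p → eval A ρ (rename σ p) ≡ eval A (ρ ∘ σ) p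
  eval-rename A ρ σ (var v) = refl
  eval-rename A ρ σ one     = refl
  eval-rename A ρ σ (neg p) = cong (CommutativeRing.-_ A) (eval-rename A ρ σ p)
  eval-rename A ρ σ (p ⊕ q) = cong₂ (CommutativeRing._+_ A) (eval-rename A ρ σ p) (eval-rename A ρ σ q)
  eval-rename A ρ σ (p ⊗ q) = cong₂ (CommutativeRing._*_ A) (eval-rename A ρ σ p) (eval-rename A ρ σ q)

  PolyEq-rename : ∀ {K} (σ : V → W) {p q} → PolyEq K p q → PolyEq K (rename σ p) (rename σ q)
  PolyEq-rename σ {p} {q} p≈q A h hom ρ = ≈-trans (reflexive (eval-rename A ρ σ p))
    (≈-trans (p≈q A h hom (ρ ∘ σ)) (reflexive (sym (eval-rename A ρ σ q))))
    where open CommutativeRing A using (reflexive) renaming (trans to ≈-trans)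

PolyEq-sym : ∀ {V : Set} {K} {p q : Poly V} → PolyEq K p q → PolyEq K q p
PolyEq-sym p≈q A h hom ρ = CommutativeRing.sym A (p≈q A h hom ρ)

Embeds : ∀ {V W : Set} → CommutativeRing 0ℓ 0ℓ → (V → W) → System V → System W → Set₁
Embeds K σ S₁ S₂ = ∀ i → ∃ λ j → PolyEq K (rename σ (System.poly S₁ i)) (System.poly S₂ j)

coincide : ∀ {V W : Set} {K} {S₁ : System V} {S₂ : System W} (σ : V → W) (τ : W → V) →
           (∀ v → τ (σ v) ≡ v) → (∀ w → σ (τ w) ≡ w) →
           Embeds K σ S₁ S₂ → Embeds K τ S₂ S₁ → Coincide K S₁ S₂
coincide {K = K} {S₁} {S₂} σ τ τσ στ emb₁ emb₂ =
  mk⤖ (injective , λ w → τ w , λ { refl → στ w }) , emb₁ , backwards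
  where
  injective : ∀ {v v′} → σ v ≡ σ v′ → v ≡ v′
  injective {v} {v′} σv≡σv′ = trans (sym (τσ v)) (trans (cong τ σv≡σv′) (τσ v′))
  backwards : ∀ j → ∃ λ i → PolyEq K (rename σ (System.poly S₁ i)) (System.poly S₂ j)
  backwards j = i , PolyEq-sym {K = K} {p = System.poly S₂ j} {q = rename σ (System.poly S₁ i)}
    (subst (λ p → PolyEq K p (rename σ (System.poly S₁ i))) (rename-inverse σ τ στ (System.poly S₂ j))
           (PolyEq-rename {K = K} σ {p = rename τ (System.poly S₂ j)} {q = System.poly S₁ i} τpj≈pi))
    where
    i = proj₁ (emb₂ j)
    τpj≈pi = proj₂ (emb₂ j)

-- The equations are symmetric under exchanging the roles of the a- and
-- b-variables (routine ring normalisation).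
module SwapIdentities (A : CommutativeRing 0ℓ 0ℓ) where
  R : AlmostCommutativeRing 0ℓ 0ℓ
  R = fromCommutativeRing A (λ _ → nothing)
  open AlmostCommutativeRing R hiding (refl; sym; trans)
  open AlmostCommutativeRing R using () renaming (refl to ≈-refl; sym to ≈-sym; trans to ≈-trans)

  two-F₂ : ∀ ae be af bf → be + ae + bf + af + 1# ≈ ae + be + af + bf + 1#
  two-F₂ = solve-∀ R

  three-F₂ : ∀ ae af ag be bf bg →
    1# + (be + (ae + (bf + (af + (bg + (ag + (be * bf + (be * bg + (be * af + (be * ag + (bf * bg
       + (bf * ae + (bf * ag + (bg * ae + (bg * af + (ae * af + (ae * ag + (af * ag + (- 1# + 1#)))))))))))))))))))
    ≈ 1# + (ae + (be + (af + (bf + (ag + (bg + (ae * af + (ae * ag + (ae * bf + (ae * bg + (af * ag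
       + (af * be + (af * bg + (ag * be + (ag * bf + (be * bf + (be * bg + (bf * bg + (- 1# + 1#)))))))))))))))))))
  three-F₂ = solve-∀ R

  two-K : ∀ ae be af bf → be * ae + bf * af ≈ ae * be + af * bf
  two-K = solve-∀ R

  three-K : ∀ ae af ag be bf bg →
    be * ae * bf * af + bf * af * bg * ag + bg * ag * be * ae + 1#
    ≈ ae * be * af * bf + af * bf * ag * bg + ag * bg * ae * be + 1#
  three-K ae af ag be bf bg = +-cong (+-cong (+-cong (swap-pairs be ae bf af) (swap-pairs bf af bg ag))
                                             (swap-pairs bg ag be ae)) ≈-refl
    where
    swap-pairs : ∀ a b c d → a * b * c * d ≈ b * a * d * c
    swap-pairs a b c d = ≈-trans (*-assoc (a * b) c d) (≈-trans (*-cong (*-comm a b) (*-comm c d)) (≈-sym (*-assoc (b * a) d c)))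

module Swap {n : ℕ} (𝒜 ℬ : CircuitFamily n)
  (circuit⇒cocircuit : ∀ {X} → T (𝒜 X) → T (dual ℬ X))
  (cocircuit⇒circuit : ∀ {Y} → T (dual 𝒜 Y) → T (ℬ Y)) where

  swapVar : Var 𝒜 → Var ℬ
  swapVar (inj₁ (X , cX , e , eX)) = inj₂ (X , circuit⇒cocircuit cX , e , eX)
  swapVar (inj₂ (Y , cY , e , eY)) = inj₁ (Y , cocircuit⇒circuit cY , e , eY)

  swapTwo : Two 𝒜 → Two ℬ
  swapTwo t = record
    { X = Y ; Y = X ; cX = cocircuit⇒circuit cY ; cY = circuit⇒cocircuit cX ; e = e ; f = f ; e≢f = e≢f
    ; meet = trans (∩-comm Y X) meet ; eX = eY ; fX = fY ; eY = eX ; fY = fX }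
    where open Two t

  swapThree : Three 𝒜 → Three ℬ
  swapThree t = record
    { X = Y ; Y = X ; cX = cocircuit⇒circuit cY ; cY = circuit⇒cocircuit cX ; e = e ; f = f ; g = g
    ; e≢f = e≢f ; e≢g = e≢g ; f≢g = f≢g ; meet = trans (∩-comm Y X) meet
    ; eX = eY ; fX = fY ; gX = gY ; eY = eX ; fY = fX ; gY = gX }
    where open Three t

  swap-F₂ : ∀ K → Embeds K swapVar (F₂System 𝒜) (F₂System ℬ)
  swap-F₂ K (inj₁ t) = inj₁ (swapTwo t) , λ A _ _ ρ →
    SwapIdentities.two-F₂ A (ρ (swapVar be)) (ρ (swapVar ae)) (ρ (swapVar bf)) (ρ (swapVar af))
    where
    open Two t
    ae = inj₁ (X , cX , e , eX) ; af = inj₁ (X , cX , f , fX)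
    be = inj₂ (Y , cY , e , eY) ; bf = inj₂ (Y , cY , f , fY)
  swap-F₂ K (inj₂ t) = inj₂ (swapThree t) , λ A _ _ ρ →
    SwapIdentities.three-F₂ A (ρ (swapVar be)) (ρ (swapVar bf)) (ρ (swapVar bg))
                              (ρ (swapVar ae)) (ρ (swapVar af)) (ρ (swapVar ag))
    where
    open Three t
    ae = inj₁ (X , cX , e , eX) ; af = inj₁ (X , cX , f , fX) ; ag = inj₁ (X , cX , g , gX)
    be = inj₂ (Y , cY , e , eY) ; bf = inj₂ (Y , cY , f , fY) ; bg = inj₂ (Y , cY , g , gY)

  swap-K : ∀ K → Embeds K swapVar (KSystem 𝒜) (KSystem ℬ)
  swap-K K (inj₁ (X , cX , e , eX)) = inj₂ (inj₁ (X , circuit⇒cocircuit cX , e , eX)) , λ A _ _ _ → CommutativeRing.refl A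
  swap-K K (inj₂ (inj₁ (Y , cY , e , eY))) = inj₁ (Y , cocircuit⇒circuit cY , e , eY) , λ A _ _ _ → CommutativeRing.refl A
  swap-K K (inj₂ (inj₂ (inj₁ t))) = inj₂ (inj₂ (inj₁ (swapTwo t))) , λ A _ _ ρ →
    SwapIdentities.two-K A (ρ (swapVar be)) (ρ (swapVar ae)) (ρ (swapVar bf)) (ρ (swapVar af))
    where
    open Two t
    ae = inj₁ (X , cX , e , eX) ; af = inj₁ (X , cX , f , fX)
    be = inj₂ (Y , cY , e , eY) ; bf = inj₂ (Y , cY , f , fY)
  swap-K K (inj₂ (inj₂ (inj₂ t))) = inj₂ (inj₂ (inj₂ (swapThree t))) , λ A _ _ ρ →
    SwapIdentities.three-K A (ρ (swapVar be)) (ρ (swapVar bf)) (ρ (swapVar bg))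
                             (ρ (swapVar ae)) (ρ (swapVar af)) (ρ (swapVar ag))
    where
    open Three t
    ae = inj₁ (X , cX , e , eX) ; af = inj₁ (X , cX , f , fX) ; ag = inj₁ (X , cX , g , gX)
    be = inj₂ (Y , cY , e , eY) ; bf = inj₂ (Y , cY , f , fY) ; bg = inj₂ (Y , cY , g , gY)

-- swapping twice returns the original variable (membership proofs are irrelevant)
swap-involutive : ∀ {n} {𝒜 ℬ : CircuitFamily n}
  {f : ∀ {X} → T (𝒜 X) → T (dual ℬ X)} {g : ∀ {Y} → T (dual 𝒜 Y) → T (ℬ Y)}
  {f′ : ∀ {X} → T (ℬ X) → T (dual 𝒜 X)} {g′ : ∀ {Y} → T (dual ℬ Y) → T (𝒜 Y)} →
  ∀ v → Swap.swapVar ℬ 𝒜 f′ g′ (Swap.swapVar 𝒜 ℬ f g v) ≡ v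
swap-involutive (inj₁ (X , cX , e , eX)) = cong (λ c → inj₁ (X , c , e , eX)) (T-irrelevant _ _)
swap-involutive (inj₂ (Y , cY , e , eY)) = cong (λ c → inj₂ (Y , c , e , eY)) (T-irrelevant _ _)

module Duality {n : ℕ} {𝒞 : CircuitFamily n} (M : IsMatroid 𝒞) where
  open DoubleDual M using (circuit⇒dual-dual; dual-dual⇒circuit)

  module ToDual   = Swap 𝒞 (dual 𝒞) circuit⇒dual-dual id
  module FromDual = Swap (dual 𝒞) 𝒞 id dual-dual⇒circuit

  dual-F₂System : ∀ K → Coincide K (F₂System 𝒞) (F₂System (dual 𝒞))
  dual-F₂System K = coincide {K = K} {S₁ = F₂System 𝒞} {S₂ = F₂System (dual 𝒞)} ToDual.swapVar FromDual.swapVar swap-involutive swap-involutive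
                    (ToDual.swap-F₂ K) (FromDual.swap-F₂ K)

  dual-KSystem : ∀ K → Coincide K (KSystem 𝒞) (KSystem (dual 𝒞))
  dual-KSystem K = coincide {K = K} {S₁ = KSystem 𝒞} {S₂ = KSystem (dual 𝒞)} ToDual.swapVar FromDual.swapVar swap-involutive swap-involutive
                            (ToDual.swap-K K) (FromDual.swap-K K)

∈tabulate⁻ : ∀ {n} {f : Fin n → Bool} {x} → x ∈ tabulate f → T (f x)
∈tabulate⁻ {f = f} {x} h = Equivalence.from BoolP.T-≡ (trans (sym (lookup∘tabulate f x)) ([]=⇒lookup h))

∈tabulate⁺ : ∀ {n} {f : Fin n → Bool} {x} → T (f x) → x ∈ tabulate f
∈tabulate⁺ {f = f} {x} t = lookup⇒[]= x (tabulate f) (trans (lookup∘tabulate f x) (Equivalence.to BoolP.T-≡ t))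

var-≡ : ∀ {n} {P : Subset n → Bool} {X X′ : Subset n} {c : T (P X)} {c′ : T (P X′)} {e e′ : Fin n}
          {h : e ∈ X} {h′ : e′ ∈ X′} → X ≡ X′ → e ≡ e′ →
        _≡_ {A = Σ (Subset n) λ X → T (P X) × Σ (Fin n) λ e → e ∈ X} (X , c , e , h) (X′ , c′ , e′ , h′)
var-≡ refl refl = cong₂ (λ c h → _ , c , _ , h) (T-irrelevant _ _) ([]=-irrelevant _ _)

varSet : ∀ {n} {𝒞 : CircuitFamily n} → Var 𝒞 → Subset n
varSet (inj₁ (X , _)) = X
varSet (inj₂ (Y , _)) = Y

varElement : ∀ {n} {𝒞 : CircuitFamily n} → Var 𝒞 → Fin n
varElement (inj₁ (_ , _ , e , _)) = e
varElement (inj₂ (_ , _ , e , _)) = e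

module Minor {n m : ℕ} {𝒞 : CircuitFamily n} (M : IsMatroid 𝒞) {𝒞′ : CircuitFamily m} (M′ : IsMatroid 𝒞′)
  (C D : Subset n) (ι : Fin m → Fin n)
  (C∩D=∅ : ∀ e → e ∈ C → e ∉ D)
  (ι-injective : ∀ i j → ι i ≡ ι j → i ≡ j)
  (ι-avoids : ∀ i → ι i ∉ (C ∪ D))
  (ι-onto : ∀ e → e ∉ (C ∪ D) → ∃ λ i → ι i ≡ e)
  (circuits′ : ∀ Z → Z ⊆ ∁ (C ∪ D) → minorCircuits 𝒞 C D Z ≡ 𝒞′ (preimage ι Z)) where

  open MatroidTheory M
  module N = MatroidTheory M′

  ι∉C : ∀ i → ι i ∉ C
  ι∉C i h = ι-avoids i (∈∪ˡ h)

  ι∉D : ∀ i → ι i ∉ D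
  ι∉D i h = ι-avoids i (∈∪ʳ h)

  -- the image of a subset of the minor's ground set; kept abstract, it is
  -- characterised by ∈img⁻ and ∈img⁺
  abstract
    img : Subset m → Subset n
    img S′ = tabulate λ j → ⌊ any? (λ i → (i ∈? S′) ×-dec (ι i ≟ j)) ⌋

    ∈img⁻ : ∀ {S′ j} → j ∈ img S′ → ∃ λ i → i ∈ S′ × ι i ≡ j
    ∈img⁻ {S′} {j} h = toWitness {a? = any? (λ i → (i ∈? S′) ×-dec (ι i ≟ j))} (∈tabulate⁻ h)

    ∈img⁺ : ∀ {S′ i} → i ∈ S′ → ι i ∈ img S′
    ∈img⁺ {S′} {i} h = ∈tabulate⁺ (fromWitness {a? = any? (λ k → (k ∈? S′) ×-dec (ι k ≟ ι i))} (i , h , refl))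

  ∈img-injective : ∀ {S′ i} → ι i ∈ img S′ → i ∈ S′
  ∈img-injective {S′} {i} h = let k , kS′ , ιk≡ιi = ∈img⁻ h in subst (_∈ S′) (ι-injective k i ιk≡ιi) kS′

  img⊆∁C∪D : ∀ {S′} → img S′ ⊆ ∁ (C ∪ D)
  img⊆∁C∪D h = let i , _ , ιi≡j = ∈img⁻ h in ∈∁⁺ (subst (_∉ (C ∪ D)) ιi≡j (ι-avoids i))

  ∈preimage⁻ : ∀ {Z i} → i ∈ preimage ι Z → ι i ∈ Z
  ∈preimage⁻ {Z} {i} h = lookup⇒[]= (ι i) Z (Equivalence.to BoolP.T-≡ (∈tabulate⁻ h))

  ∈preimage⁺ : ∀ {Z i} → ι i ∈ Z → i ∈ preimage ι Z
  ∈preimage⁺ h = ∈tabulate⁺ (Equivalence.from BoolP.T-≡ ([]=⇒lookup h))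

  preimage-img : ∀ S′ → preimage ι (img S′) ≡ S′
  preimage-img S′ = ⊆-antisym (λ h → ∈img-injective (∈preimage⁻ h)) (λ h → ∈preimage⁺ (∈img⁺ h))

  img-∪ : ∀ S′ T′ → img (S′ ∪ T′) ≡ img S′ ∪ img T′
  img-∪ S′ T′ = ⊆-antisym
    (λ h → let i , iS∪T , ιi≡j = ∈img⁻ h in
           [ (λ iS → ∈∪ˡ (subst (_∈ img S′) ιi≡j (∈img⁺ iS))) , (λ iT → ∈∪ʳ (subst (_∈ img T′) ιi≡j (∈img⁺ iT))) ]′ (∈∪⁻ iS∪T))
    (∪-⊆ (λ h → let i , iS , ιi≡j = ∈img⁻ h in subst (_∈ img (S′ ∪ T′)) ιi≡j (∈img⁺ (∈∪ˡ iS)))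
         (λ h → let i , iT , ιi≡j = ∈img⁻ h in subst (_∈ img (S′ ∪ T′)) ιi≡j (∈img⁺ (∈∪ʳ iT))))

  img-⁅⁆ : ∀ e → img ⁅ e ⁆ ≡ ⁅ ι e ⁆
  img-⁅⁆ e = ⊆-antisym
    (λ h → let i , i≡e , ιi≡j = ∈img⁻ h in ∈⁅⁆⁺ (trans (sym ιi≡j) (cong ι (∈⁅⁆⁻ i≡e))))
    (λ h → subst (_∈ img ⁅ e ⁆) (sym (∈⁅⁆⁻ h)) (∈img⁺ (x∈⁅x⁆ e)))

  differenceᵇ : Subset n → Bool
  differenceᵇ W = anySub (λ X → 𝒞 X ∧ (W ≡ᵇ (X ─ C)))

  difference⁺ : ∀ {X} → Circuit X → T (differenceᵇ (X ─ C))
  difference⁺ {X} cX = anySub⁺ _ X (T-∧⁺ cX (≡⇒≡ᵇ {X = X ─ C} refl))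

  difference⁻ : ∀ {W} → T (differenceᵇ W) → ∃ λ X → Circuit X × W ≡ X ─ C
  difference⁻ {W} h = let X , t = anySub⁻ _ h in X , proj₁ (T-∧⁻ {𝒞 X} t) , ≡ᵇ⇒≡ (proj₂ (T-∧⁻ {𝒞 X} t))

  minor-circuit⇒difference : ∀ {Z} → T (minorCircuits 𝒞 C D Z) → ∃ λ X → Circuit X × Z ≡ X ─ C
  minor-circuit⇒difference {Z} h =
    difference⁻ (proj₁ (T-∧⁻ {differenceᵇ Z} (proj₂ (T-∧⁻ {nonemptyᵇ Z} (proj₁ (T-∧⁻ {contract 𝒞 C Z} h))))))

  smaller-difference : ∀ X₁ X₂ {x u} → Circuit X₁ → Circuit X₂ → x ∈ X₁ → x ∉ X₂ → u ∈ X₂ → u ∉ C →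
                       X₂ ─ C ⊆ X₁ ─ C → ∃ λ Z → Circuit Z × x ∈ Z × Z ─ C ⊂ X₁ ─ C
  smaller-difference X₁ X₂ {x} {u} c₁ c₂ xX₁ x∉X₂ uX₂ u∉C X₂∖C⊆X₁∖C =
    Z , cZ , xZ , Z∖C⊆X₁∖C , u , X₂∖C⊆X₁∖C (∈─⁺ uX₂ u∉C) , λ h → u∉Z (proj₁ (∈─⁻ Z C h))
    where
    uX₁ : u ∈ X₁
    uX₁ = proj₁ (∈─⁻ X₁ C (X₂∖C⊆X₁∖C (∈─⁺ uX₂ u∉C)))
    open CircuitThrough (strong-elimination X₁ X₂ c₁ c₂ uX₁ uX₂ xX₁ x∉X₂)
      renaming (circuit to Z; isCircuit to cZ; ∋e to xZ; ⊆S to Z⊆)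
    u∉Z : u ∉ Z
    u∉Z uZ = proj₂ (∈─⁻ (X₁ ∪ X₂) ⁅ u ⁆ (Z⊆ uZ)) (x∈⁅x⁆ u)
    Z∖C⊆X₁∖C : Z ─ C ⊆ X₁ ─ C
    Z∖C⊆X₁∖C h with ∈─⁻ Z C h
    ... | zZ , z∉C = [ (λ zX₁ → ∈─⁺ zX₁ z∉C) , (λ zX₂ → X₂∖C⊆X₁∖C (∈─⁺ zX₂ z∉C)) ]′
                       (∈∪⁻ (proj₁ (∈─⁻ (X₁ ∪ X₂) ⁅ u ⁆ (Z⊆ zZ))))

  record MinorCircuitThrough (x : Fin n) (X : Subset n) : Set where
    field
      circuit        : Subset n
      isMinorCircuit : T (minorCircuits 𝒞 C D circuit)
      ∋x             : x ∈ circuit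
      ⊆X∖C           : circuit ⊆ X ─ C

  minor-circuit-through : ∀ X {x} → Circuit X → (∀ z → z ∈ X → z ∉ D) → x ∈ X → x ∉ C → MinorCircuitThrough x X
  minor-circuit-through X {x} cX X∩D=∅ xX x∉C = record
    { circuit = set ; ∋x = x∈set ; ⊆X∖C = ⊆S
    ; isMinorCircuit =
        T-∧⁺ (T-∧⁺ (⇒nonemptyᵇ (x , x∈set)) (T-∧⁺ (proj₁ holds′) (allSub⁺ _ λ U → T-not⁺ (no-smaller U))))
             (≡⇒≡ᵇ (⊆-antisym (λ h → ∈─⁺ h λ hD → X∩D=∅ _ (proj₁ (∈─⁻ X C (⊆S h))) hD) (λ h → proj₁ (∈─⁻ set D h)))) }
    where
    -- minimal differences containing x
    through-x : Subset n → Bool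
    through-x W = differenceᵇ W ∧ ⌊ x ∈? W ⌋
    open MinimalIn (minimalIn through-x (X ─ C) (T-∧⁺ (difference⁺ cX) (fromWitness (∈─⁺ xX x∉C))))
    holds′ : T (differenceᵇ set) × x ∈ set
    holds′ = let d , x∈ = T-∧⁻ {differenceᵇ set} holds in d , toWitness x∈
    x∈set = proj₂ holds′
    no-smaller : ∀ U → ¬ T (U ⊂ᵇ set ∧ nonemptyᵇ U ∧ differenceᵇ U)
    no-smaller U h with T-∧⁻ {U ⊂ᵇ set} h
    ... | U⊂ᵇset , rest with ⊂ᵇ⇒⊂ U⊂ᵇset | T-∧⁻ {nonemptyᵇ U} rest
    ...   | U⊂set | neU , dU with x ∈? U
    ...     | yes xU = minimal U U⊂set (T-∧⁺ dU (fromWitness xU))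
    ...     | no x∉U = shrink (difference⁻ (proj₁ holds′)) (difference⁻ dU) (nonemptyᵇ⇒ neU)
      where
      -- writing set = X₁ ─ C and U = X₂ ─ C, a smaller difference through x exists
      shrink : (∃ λ X₁ → Circuit X₁ × set ≡ X₁ ─ C) → (∃ λ X₂ → Circuit X₂ × U ≡ X₂ ─ C) → Nonempty U → ⊥
      shrink (X₁ , c₁ , set≡) (X₂ , c₂ , U≡) (u , uU) =
        let uX₂ , u∉C = ∈─⁻ X₂ C (subst (u ∈_) U≡ uU)
            Z , cZ , xZ , Z∖C⊂ = smaller-difference X₁ X₂ c₁ c₂ xX₁ x∉X₂ uX₂ u∉C
                                   (λ h → subst (_ ∈_) set≡ (proj₁ U⊂set (subst (_ ∈_) (sym U≡) h)))
        in minimal (Z ─ C) (subst (Z ─ C ⊂_) (sym set≡) Z∖C⊂) (T-∧⁺ (difference⁺ cZ) (fromWitness (∈─⁺ xZ x∉C)))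
        where
        xX₁ : x ∈ X₁
        xX₁ = proj₁ (∈─⁻ X₁ C (subst (x ∈_) set≡ x∈set))
        x∉X₂ : x ∉ X₂
        x∉X₂ xX₂ = x∉U (subst (x ∈_) (sym U≡) (∈─⁺ xX₂ x∉C))

  record CircuitLift (X′ : Subset m) : Set where
    field
      set       : Subset n
      circuit   : Circuit set
      ⊆img∪C    : set ⊆ img X′ ∪ C
      preimage≡ : preimage ι set ≡ X′

  lift-circuit : ∀ {X′} → N.Circuit X′ → CircuitLift X′
  lift-circuit {X′} cX′ = record { set = X ; circuit = cX ; ⊆img∪C = X⊆ ; preimage≡ = preimage≡ }
    where
    minor : T (minorCircuits 𝒞 C D (img X′))
    minor = subst T (sym (trans (circuits′ (img X′) img⊆∁C∪D) (cong 𝒞′ (preimage-img X′)))) cX′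
    lifted = minor-circuit⇒difference minor
    X = proj₁ lifted
    cX = proj₁ (proj₂ lifted)
    img≡ : img X′ ≡ X ─ C
    img≡ = proj₂ (proj₂ lifted)
    X⊆ : X ⊆ img X′ ∪ C
    X⊆ {z} zX with z ∈? C
    ... | yes zC = ∈∪ʳ zC
    ... | no z∉C = ∈∪ˡ (subst (z ∈_) (sym img≡) (∈─⁺ zX z∉C))
    preimage≡ : preimage ι X ≡ X′
    preimage≡ = ⊆-antisym (λ h → ∈img-injective (subst (_ ∈_) (sym img≡) (∈─⁺ (∈preimage⁻ h) (ι∉C _))))
                          (λ h → ∈preimage⁺ (proj₁ (∈─⁻ X C (subst (_ ∈_) img≡ (∈img⁺ h)))))

  lift-∈ : ∀ {X′} (Lx : CircuitLift X′) {e} → e ∈ X′ → ι e ∈ CircuitLift.set Lx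
  lift-∈ Lx {e} h = ∈preimage⁻ (subst (e ∈_) (sym (CircuitLift.preimage≡ Lx)) h)

  cl-lift : ∀ {S′ e′} → e′ N.∈cl S′ → ι e′ ∈cl (img S′ ∪ C)
  cl-lift (inj₁ e′S′) = inj₁ (∈∪ˡ (∈img⁺ e′S′))
  cl-lift {S′} {e′} (inj₂ (N.circuitThrough X′ cX′ e′X′ X′⊆)) =
    inj₂ (circuitThrough set circuit (lift-∈ L e′X′) set⊆)
    where
    L = lift-circuit cX′
    open CircuitLift L
    set⊆ : set ⊆ (img S′ ∪ C) ∪ ⁅ ι e′ ⁆
    set⊆ h with ∈∪⁻ (⊆img∪C h)
    ... | inj₂ zC = ∈∪ˡ (∈∪ʳ zC)
    ... | inj₁ z∈img with ∈img⁻ z∈img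
    ...   | i , iX′ , ιi≡z = [ (λ iS′ → ∈∪ˡ (∈∪ˡ (subst (_∈ img S′) ιi≡z (∈img⁺ iS′))))
                             , (λ i≡e′ → ∈∪ʳ (∈⁅⁆⁺ (trans (sym ιi≡z) (cong ι (∈⁅⁆⁻ i≡e′))))) ]′ (∈∪⁻ (X′⊆ iX′))

  cl-descend : ∀ {S′ e′} → ι e′ ∈cl (img S′ ∪ C) → e′ N.∈cl S′
  cl-descend (inj₁ h) = inj₁ ([ ∈img-injective , (λ ιe′C → ⊥-elim (ι∉C _ ιe′C)) ]′ (∈∪⁻ h))
  cl-descend {S′} {e′} (inj₂ (circuitThrough X cX ιe′X X⊆)) =
    inj₂ (N.circuitThrough (preimage ι Z) (subst T (circuits′ Z Z⊆∁C∪D) minorZ) (∈preimage⁺ ιe′Z) preimage⊆)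
    where
    X∩D=∅ : ∀ z → z ∈ X → z ∉ D
    X∩D=∅ z zX zD = [ [ (λ zimg → ∈∁⁻ (img⊆∁C∪D zimg) (∈∪ʳ zD)) , (λ zC → C∩D=∅ z zC zD) ]′ ∘ ∈∪⁻
                    , (λ z≡ιe′ → ι∉D e′ (subst (_∈ D) (∈⁅⁆⁻ z≡ιe′) zD)) ]′ (∈∪⁻ (X⊆ zX))
    open MinorCircuitThrough (minor-circuit-through X cX X∩D=∅ ιe′X (ι∉C e′))
      renaming (circuit to Z; isMinorCircuit to minorZ; ∋x to ιe′Z; ⊆X∖C to Z⊆X∖C)
    Z⊆∁C∪D : Z ⊆ ∁ (C ∪ D)
    Z⊆∁C∪D h = let zX , z∉C = ∈─⁻ X C (Z⊆X∖C h) in ∈∁⁺ λ w → [ z∉C , X∩D=∅ _ zX ]′ (∈∪⁻ w)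
    preimage⊆ : preimage ι Z ⊆ S′ ∪ ⁅ e′ ⁆
    preimage⊆ {i} h with ∈─⁻ X C (Z⊆X∖C (∈preimage⁻ h))
    ... | ιiX , _ = [ [ (λ ιi∈img → ∈∪ˡ (∈img-injective ιi∈img)) , (λ ιiC → ⊥-elim (ι∉C i ιiC)) ]′ ∘ ∈∪⁻
                    , (λ ιi≡ιe′ → ∈∪ʳ (∈⁅⁆⁺ (ι-injective i e′ (∈⁅⁆⁻ ιi≡ιe′)))) ]′ (∈∪⁻ (X⊆ ιiX))

  spanning-lift : ∀ {S′} → N.Spanning S′ → ∀ e → e ∉ D → e ∈cl (img S′ ∪ C)
  spanning-lift {S′} sp e e∉D with e ∈? C
  ... | yes eC = inj₁ (∈∪ʳ eC)
  ... | no e∉C = let i , ιi≡e = ι-onto e (λ h → [ e∉C , e∉D ]′ (∈∪⁻ h))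
                 in subst (_∈cl (img S′ ∪ C)) ιi≡e (cl-lift (sp i))

  spanning-descend : ∀ {S′} → (∀ e → e ∉ D → e ∈cl (img S′ ∪ C)) → N.Spanning S′
  spanning-descend sp e′ = cl-descend (sp (ι e′) (ι∉D e′))

  -- a maximal coindependent subset of the deleted set D; only its specification
  -- matters, so the construction is kept abstract
  abstract
    ID : MaximalCoindependent D
    ID = maximal-coindependent D
  module ID = MaximalCoindependent ID

  ∁-splits : ∀ Y′ → ∁ (img Y′ ∪ ID.set) ⊆ (img (∁ Y′) ∪ C) ∪ (D ─ ID.set)
  ∁-splits Y′ {z} h with z ∈? C | z ∈? D
  ... | yes zC | _      = ∈∪ˡ (∈∪ʳ zC)
  ... | no _   | yes zD = ∈∪ʳ (∈─⁺ zD λ zI → ∈∁⁻ h (∈∪ʳ zI))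
  ... | no z∉C | no z∉D = let i , ιi≡z = ι-onto z (λ w → [ z∉C , z∉D ]′ (∈∪⁻ w)) in
    ∈∪ˡ (∈∪ˡ (subst (_∈ img (∁ Y′)) ιi≡z (∈img⁺ (∈∁⁺ λ iY′ → ∈∁⁻ h (∈∪ˡ (subst (_∈ img Y′) ιi≡z (∈img⁺ iY′)))))))

  ∁-contains : ∀ Y′ → img (∁ Y′) ∪ C ⊆ ∁ (img Y′ ∪ ID.set)
  ∁-contains Y′ = ∪-⊆
    (λ h → let i , i∉Y′ , ιi≡z = ∈img⁻ h in ∈∁⁺ λ w →
      [ (λ z∈img → ∈∁⁻ i∉Y′ (∈img-injective (subst (_∈ img Y′) (sym ιi≡z) z∈img)))
      , (λ zI → ∈∁⁻ (img⊆∁C∪D h) (∈∪ʳ (ID.⊆D zI))) ]′ (∈∪⁻ w))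
    (λ {z} zC → ∈∁⁺ λ w → [ (λ z∈img → ∈∁⁻ (img⊆∁C∪D z∈img) (∈∪ˡ zC)) , (λ zI → C∩D=∅ z zC (ID.⊆D zI)) ]′ (∈∪⁻ w))

  img∪C⊆∁D : ∀ S′ → img S′ ∪ C ⊆ ∁ D
  img∪C⊆∁D S′ = ∪-⊆ (λ h → ∈∁⁺ λ zD → ∈∁⁻ (img⊆∁C∪D h) (∈∪ʳ zD)) (λ {z} zC → ∈∁⁺ (C∩D=∅ z zC))

  coindependent-descend : ∀ Y′ → Coindependent (img Y′ ∪ ID.set) → N.Coindependent Y′
  coindependent-descend Y′ cY = N.spanning∁⇒coindependent (spanning-descend λ e e∉D →
    cl-without-coloops ID (img∪C⊆∁D (∁ Y′)) e∉D (cl-mono (∁-splits Y′) (coindependent⇒spanning∁ cY e)))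

  coindependent-lift : ∀ Y′ → N.Coindependent Y′ → Coindependent (img Y′ ∪ ID.set)
  coindependent-lift Y′ cY′ = spanning∁⇒coindependent (spanning-trans (coindependent⇒spanning∁ ID.coindependent) ∁ID⊆cl)
    where
    ∁ID⊆cl : ∁ ID.set ⊆cl ∁ (img Y′ ∪ ID.set)
    ∁ID⊆cl z z∉ID with z ∈? D
    ... | yes zD = inj₁ (∈∁⁺ λ w → [ (λ z∈img → ∈∁⁻ (img⊆∁C∪D z∈img) (∈∪ʳ zD)) , ∈∁⁻ z∉ID ]′ (∈∪⁻ w))
    ... | no z∉D = cl-mono (∁-contains Y′) (spanning-lift (N.coindependent⇒spanning∁ cY′) z z∉D)

  record CocircuitLift (Y′ : Subset m) : Set where
    field
      set       : Subset n
      cocircuit : T (dual 𝒞 set)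
      ⊆img∪D    : set ⊆ img Y′ ∪ D
      preimage≡ : preimage ι set ≡ Y′

  lift-cocircuit : ∀ {Y′} → T (dual 𝒞′ Y′) → CocircuitLift Y′
  lift-cocircuit {Y′} h = record
    { set = Y ; cocircuit = Cocircuit⇒dual coY ; ⊆img∪D = λ w → [ ∈∪ˡ , (λ zI → ∈∪ʳ (ID.⊆D zI)) ]′ (∈∪⁻ (Y⊆ w))
    ; preimage≡ = ⊆-antisym Y″⊆Y′ (Y′⊆Y″ (⊆-or-witness Y′ (preimage ι Y))) }
    where
    coY′ : N.Cocircuit Y′
    coY′ = N.dual⇒Cocircuit h
    -- ι Y′ ∪ ID is not coindependent, so it contains a cocircuit Y of M
    found : ∃ λ Y → Y ⊆ img Y′ ∪ ID.set × Cocircuit Y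
    found = cocircuit-within (img Y′ ∪ ID.set) (λ c → proj₁ coY′ (coindependent-descend Y′ c))
    Y : Subset n
    Y = proj₁ found
    Y⊆ : Y ⊆ img Y′ ∪ ID.set
    Y⊆ = proj₁ (proj₂ found)
    coY : Cocircuit Y
    coY = proj₂ (proj₂ found)
    Y″⊆Y′ : preimage ι Y ⊆ Y′
    Y″⊆Y′ {i} w = [ ∈img-injective , (λ ιiI → ⊥-elim (ι∉D i (ID.⊆D ιiI))) ]′ (∈∪⁻ (Y⊆ (∈preimage⁻ w)))
    Y⊆ιY″∪ID : Y ⊆ img (preimage ι Y) ∪ ID.set
    Y⊆ιY″∪ID {z} zY = [ in-image , ∈∪ʳ ]′ (∈∪⁻ (Y⊆ zY))
      where
      in-image : z ∈ img Y′ → z ∈ img (preimage ι Y) ∪ ID.set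
      in-image z∈img = ∈∪ˡ (from-preimage (∈img⁻ z∈img))
        where
        from-preimage : (∃ λ i → i ∈ Y′ × ι i ≡ z) → z ∈ img (preimage ι Y)
        from-preimage (i , _ , refl) = ∈img⁺ (∈preimage⁺ zY)
    -- hence the preimage of Y is not coindependent in the minor, so by minimality it is Y′
    Y′⊆Y″ : Y′ ⊆ preimage ι Y ⊎ (∃ λ y → y ∈ Y′ × y ∉ preimage ι Y) → Y′ ⊆ preimage ι Y
    Y′⊆Y″ (inj₁ Y′⊆) = Y′⊆
    Y′⊆Y″ (inj₂ (y , yY′ , y∉)) = ⊥-elim (proj₁ coY (coindependent-anti Y⊆ιY″∪ID
      (coindependent-lift (preimage ι Y) (proj₂ coY′ (preimage ι Y) (Y″⊆Y′ , y , yY′ , y∉)))))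

  colift-∈ : ∀ {Y′} (Ly : CocircuitLift Y′) {e} → e ∈ Y′ → ι e ∈ CocircuitLift.set Ly
  colift-∈ Ly {e} h = ∈preimage⁻ (subst (e ∈_) (sym (CocircuitLift.preimage≡ Ly)) h)

  lift-meet : ∀ {X′ Y′} (Lx : CircuitLift X′) (Ly : CocircuitLift Y′) →
              CircuitLift.set Lx ∩ CocircuitLift.set Ly ≡ img (X′ ∩ Y′)
  lift-meet {X′} {Y′} Lx Ly = ⊆-antisym to from
    where
    open CircuitLift Lx renaming (set to X; ⊆img∪C to X⊆)
    open CocircuitLift Ly renaming (set to Y; ⊆img∪D to Y⊆; preimage≡ to preimageY≡)
    in-meet : ∀ {z} → z ∈ Y → (∃ λ i → i ∈ X′ × ι i ≡ z) → z ∈ img (X′ ∩ Y′)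
    in-meet zY (i , iX′ , refl) = ∈img⁺ (∈∩⁺ iX′ (subst (i ∈_) preimageY≡ (∈preimage⁺ zY)))
    to : X ∩ Y ⊆ img (X′ ∩ Y′)
    to {z} h with ∈∩⁻ h
    ... | zX , zY = [ (λ z∈img → in-meet zY (∈img⁻ z∈img))
                    , (λ zC → ⊥-elim ([ (λ z∈img → ∈∁⁻ (img⊆∁C∪D z∈img) (∈∪ˡ zC)) , C∩D=∅ z zC ]′ (∈∪⁻ (Y⊆ zY)))) ]′
                    (∈∪⁻ (X⊆ zX))
    in-lifts : ∀ {z} → (∃ λ i → i ∈ X′ ∩ Y′ × ι i ≡ z) → z ∈ X ∩ Y
    in-lifts (i , iX′∩Y′ , refl) = ∈∩⁺ (lift-∈ Lx (proj₁ (∈∩⁻ iX′∩Y′))) (colift-∈ Ly (proj₂ (∈∩⁻ iX′∩Y′)))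
    from : img (X′ ∩ Y′) ⊆ X ∩ Y
    from h = in-lifts (∈img⁻ h)

  liftA : VarA 𝒞′ → VarA 𝒞
  liftA (X′ , cX′ , e , eX′) = CircuitLift.set Lx , CircuitLift.circuit Lx , ι e , lift-∈ Lx eX′
    where Lx = lift-circuit cX′

  liftB : VarB 𝒞′ → VarB 𝒞
  liftB (Y′ , cY′ , e , eY′) = CocircuitLift.set Ly , CocircuitLift.cocircuit Ly , ι e , colift-∈ Ly eY′
    where Ly = lift-cocircuit cY′

  liftVar : Var 𝒞′ → Var 𝒞
  liftVar (inj₁ a) = inj₁ (liftA a)
  liftVar (inj₂ b) = inj₂ (liftB b)

  -- the lifted set determines the original one, so the relabeling is injective
  liftVar-injective : ∀ {v w} → liftVar v ≡ liftVar w → v ≡ w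
  liftVar-injective {inj₁ (X₁ , c₁ , e₁ , _)} {inj₁ (X₂ , c₂ , e₂ , _)} eq = cong inj₁ (var-≡
    (trans (sym (CircuitLift.preimage≡ (lift-circuit c₁)))
      (trans (cong (preimage ι) (cong varSet eq)) (CircuitLift.preimage≡ (lift-circuit c₂))))
    (ι-injective e₁ e₂ (cong varElement eq)))
  liftVar-injective {inj₂ (Y₁ , c₁ , e₁ , _)} {inj₂ (Y₂ , c₂ , e₂ , _)} eq = cong inj₂ (var-≡
    (trans (sym (CocircuitLift.preimage≡ (lift-cocircuit c₁)))
      (trans (cong (preimage ι) (cong varSet eq)) (CocircuitLift.preimage≡ (lift-cocircuit c₂))))
    (ι-injective e₁ e₂ (cong varElement eq)))
  liftVar-injective {inj₁ _} {inj₂ _} ()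
  liftVar-injective {inj₂ _} {inj₁ _} ()

  liftTwo : Two 𝒞′ → Two 𝒞
  liftTwo t = record
    { X = CircuitLift.set Lx ; Y = CocircuitLift.set Ly ; cX = CircuitLift.circuit Lx ; cY = CocircuitLift.cocircuit Ly
    ; e = ι e ; f = ι f ; e≢f = λ ιe≡ιf → e≢f (ι-injective e f ιe≡ιf)
    ; meet = trans (lift-meet Lx Ly) (trans (cong img meet) (trans (img-∪ ⁅ e ⁆ ⁅ f ⁆) (cong₂ _∪_ (img-⁅⁆ e) (img-⁅⁆ f))))
    ; eX = lift-∈ Lx eX ; fX = lift-∈ Lx fX ; eY = colift-∈ Ly eY ; fY = colift-∈ Ly fY }
    where
    open Two t
    Lx = lift-circuit cX
    Ly = lift-cocircuit cY

  liftThree : Three 𝒞′ → Three 𝒞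
  liftThree t = record
    { X = CircuitLift.set Lx ; Y = CocircuitLift.set Ly ; cX = CircuitLift.circuit Lx ; cY = CocircuitLift.cocircuit Ly
    ; e = ι e ; f = ι f ; g = ι g
    ; e≢f = λ ιe≡ιf → e≢f (ι-injective e f ιe≡ιf) ; e≢g = λ ιe≡ιg → e≢g (ι-injective e g ιe≡ιg)
    ; f≢g = λ ιf≡ιg → f≢g (ι-injective f g ιf≡ιg)
    ; meet = trans (lift-meet Lx Ly) (trans (cong img meet) (trans (img-∪ ⁅ e ⁆ (⁅ f ⁆ ∪ ⁅ g ⁆))
               (cong₂ _∪_ (img-⁅⁆ e) (trans (img-∪ ⁅ f ⁆ ⁅ g ⁆) (cong₂ _∪_ (img-⁅⁆ f) (img-⁅⁆ g))))))
    ; eX = lift-∈ Lx eX ; fX = lift-∈ Lx fX ; gX = lift-∈ Lx gX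
    ; eY = colift-∈ Ly eY ; fY = colift-∈ Ly fY ; gY = colift-∈ Ly gY }
    where
    open Three t
    Lx = lift-circuit cX
    Ly = lift-cocircuit cY

  lift-F₂ : ∀ K → Embeds K liftVar (F₂System 𝒞′) (F₂System 𝒞)
  lift-F₂ K (inj₁ t) = inj₁ (liftTwo t) , λ A _ _ _ → CommutativeRing.refl A
  lift-F₂ K (inj₂ t) = inj₂ (liftThree t) , λ A _ _ _ → CommutativeRing.refl A

  lift-K : ∀ K → Embeds K liftVar (KSystem 𝒞′) (KSystem 𝒞)
  lift-K K (inj₁ a) = inj₁ (liftA a) , λ A _ _ _ → CommutativeRing.refl A
  lift-K K (inj₂ (inj₁ b)) = inj₂ (inj₁ (liftB b)) , λ A _ _ _ → CommutativeRing.refl A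
  lift-K K (inj₂ (inj₂ (inj₁ t))) = inj₂ (inj₂ (inj₁ (liftTwo t))) , λ A _ _ _ → CommutativeRing.refl A
  lift-K K (inj₂ (inj₂ (inj₂ t))) = inj₂ (inj₂ (inj₂ (liftThree t))) , λ A _ _ _ → CommutativeRing.refl A

  minor-F₂System : ∀ K → Subsystem K (F₂System 𝒞′) (F₂System 𝒞)
  minor-F₂System K = mk↣ liftVar-injective , lift-F₂ K

  minor-KSystem : ∀ K → Subsystem K (KSystem 𝒞′) (KSystem 𝒞)
  minor-KSystem K = mk↣ liftVar-injective , lift-K K

lemma3p5 : ∀ (n : ℕ) (𝒞 : CircuitFamily n) → IsMatroid 𝒞 →
    ( Coincide F₂ (F₂System 𝒞) (F₂System (dual 𝒞))
      × (∀ (K : CommutativeRing 0ℓ 0ℓ) → IsFieldCharNot2 K →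
           Coincide K (KSystem 𝒞) (KSystem (dual 𝒞))) )
    × (∀ (m : ℕ) (𝒞′ : CircuitFamily m) → IsMatroid 𝒞′ → IsMinorOf 𝒞′ 𝒞 →
         Subsystem F₂ (F₂System 𝒞′) (F₂System 𝒞)
         × (∀ (K : CommutativeRing 0ℓ 0ℓ) → IsFieldCharNot2 K →
              Subsystem K (KSystem 𝒞′) (KSystem 𝒞)))
lemma3p5 n 𝒞 M = (dual-F₂System F₂ , λ K _ → dual-KSystem K) , minors
  where
  open Duality M
  minors : ∀ m (𝒞′ : CircuitFamily m) → IsMatroid 𝒞′ → IsMinorOf 𝒞′ 𝒞 →
           Subsystem F₂ (F₂System 𝒞′) (F₂System 𝒞) × (∀ K → IsFieldCharNot2 K → Subsystem K (KSystem 𝒞′) (KSystem 𝒞))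
  minors m 𝒞′ M′ (C , D , ι , C∩D=∅ , ι-injective , ι-avoids , ι-onto , circuits′) =
    minor-F₂System F₂ , λ K _ → minor-KSystem K
    where open Minor M M′ C D ι C∩D=∅ ι-injective ι-avoids ι-onto circuits′
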